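{- For every integer $n\ge1$, $$\det(M_n;\mathbb N_n,1)=(-1)^{\binom n2}a^n x^{\binom n2}[n]_{t,u}!\prod_{m=1}^{n-1}\prod_{i=1}^{m}\bigl(1-ax^{i}[m-i+1]_{x,y}\bigr),$$ where $\mathbb N_n=\frac{(n+1)(n+2)}2$.
   Context: $[n]_{p,q}=\frac{p^n-q^n}{p-q}$ (so $[0]_{p,q}=0$) and $[n]_{p,q}!=\prod_{m=1}^n[m]_{p,q}$. For $n\ge0$, $M_n$ is the $\mathbb N_n\times\mathbb N_n$ matrix with entries in $\mathbb Z[a,x,y,t,u]$ whose rows and columns are indexed by pairs $(i,j)$ with $1\le j\le i\le n+1$, the pair $(i,j)$ being in position $\frac{i(i-1)}2+j$, with entries $M_n[(i,j),(i,j)]=1-ax^{j-1}[i-j]_{x,y}$; $M_n[(i,j),(i,j+1)]=-ax^{j-1}[i-j]_{x,y}$ for $1\le j\le i-1$; $M_n[(i,j),(i+1,j)]=M_n[(i,j),(i+1,j+1)]=-ax^{j-1}y^{i-j}[i]_{t,u}$ for $i\le n$; all other entries $0$. (Equivalently $M_n=I-aA$, where $A$ is the weighted adjacency matrix of the digraph on $\{(p,q)\in\mathbb N^2:p+q\le n\}$ with edges $(p,q)\to(p,q+1),(p+1,q)$ of weight $x^py^q[p+q+1]_{t,u}$ and $(p,q)\to(p,q)$ ($q>0$), $(p+1,q-1)$ of weight $x^p[q]_{x,y}$.) For a matrix $B$, $(B;r,c)$ denotes $B$ with row $r$ and column $c$ deleted. -}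

module Defs where

open import Level using (Level)
open import Data.Nat using (ℕ; zero; suc; _∸_; _≡ᵇ_; _<ᵇ_; _≤ᵇ_)
import Data.Nat as ℕ
open import Data.Nat.Combinatorics using (_C_)
open import Data.Bool using (Bool; true; false; if_then_else_; _∧_; _∨_)
open import Data.Product using (_×_; _,_)
open import Data.Fin using (Fin; zero; suc; toℕ; punchIn; fromℕ)
open import Algebra.Bundles using (CommutativeRing)

-- triangular numbers: tri k = k(k+1)/2, arranged so that
-- tri (suc n) = suc (n + tri n) holds definitionally.
tri : ℕ → ℕ
tri zero = zero
tri (suc k) = suc k ℕ.+ tri k

𝓝 : ℕ → ℕ
𝓝 n = tri (suc n)

-- decode a 1-based position p into the pair (i , j), 1 ≤ j ≤ i,
-- with p = i(i-1)/2 + j.  First argument is fuel.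
decodeGo : ℕ → ℕ → ℕ → ℕ × ℕ
decodeGo zero i k = i , k
decodeGo (suc f) i k = if k ≤ᵇ i then (i , k) else decodeGo f (suc i) (k ∸ i)

decode : ℕ → ℕ × ℕ
decode p = decodeGo p 1 p

module WithRing {c ℓ : Level} (R : CommutativeRing c ℓ) where
  open CommutativeRing R hiding (zero)

  pow : Carrier → ℕ → Carrier
  pow r zero = 1#
  pow r (suc k) = r * pow r k

  -- [n]_{p,q} = (p^n - q^n)/(p - q) = Σ_{k<n} p^k q^{n-1-k}
  qnum : Carrier → Carrier → ℕ → Carrier
  qnum p q zero = 0#
  qnum p q (suc k) = pow p k + q * qnum p q k

  prod : ℕ → (ℕ → Carrier) → Carrier
  prod zero f = 1#
  prod (suc k) f = prod k f * f (suc k)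

  qfact : Carrier → Carrier → ℕ → Carrier
  qfact p q k = prod k (qnum p q)

  sumFin : (k : ℕ) → (Fin k → Carrier) → Carrier
  sumFin zero f = 0#
  sumFin (suc k) f = f zero + sumFin k (λ j → f (suc j))

  minor : {k : ℕ} → (Fin (suc k) → Fin (suc k) → Carrier) →
          Fin (suc k) → Fin (suc k) → Fin k → Fin k → Carrier
  minor B r c i j = B (punchIn r i) (punchIn c j)

  det : (k : ℕ) → (Fin k → Fin k → Carrier) → Carrier
  det zero B = 1#
  det (suc k) B =
    sumFin (suc k) (λ j → pow (- 1#) (toℕ j) * (B zero j * det k (minor B zero j)))

  entry : Carrier → Carrier → Carrier → Carrier → Carrier → ℕ →
          ℕ × ℕ → ℕ × ℕ → Carrier
  entry a x y t u n (i , j) (i' , j') =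
    if (i' ≡ᵇ i) ∧ (j' ≡ᵇ j)
      then 1# - a * pow x (j ∸ 1) * qnum x y (i ∸ j)
    else if (i' ≡ᵇ i) ∧ (j' ≡ᵇ suc j) ∧ (j <ᵇ i)
      then - (a * pow x (j ∸ 1) * qnum x y (i ∸ j))
    else if (i' ≡ᵇ suc i) ∧ ((j' ≡ᵇ j) ∨ (j' ≡ᵇ suc j)) ∧ (i ≤ᵇ n)
      then - (a * pow x (j ∸ 1) * pow y (i ∸ j) * qnum t u i)
    else 0#

  -- the 𝓝 n × 𝓝 n matrix M_n; 0-based Fin index r is position r+1
  M : Carrier → Carrier → Carrier → Carrier → Carrier → (n : ℕ) →
      Fin (𝓝 n) → Fin (𝓝 n) → Carrier
  M a x y t u n r s = entry a x y t u n (decode (suc (toℕ r))) (decode (suc (toℕ s)))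

  -- det(M_n; 𝓝 n, 1): delete the last row and the first column
  lhs : Carrier → Carrier → Carrier → Carrier → Carrier → ℕ → Carrier
  lhs a x y t u n = det (n ℕ.+ tri n) (minor (M a x y t u n) (fromℕ (n ℕ.+ tri n)) zero)

  rhs : Carrier → Carrier → Carrier → Carrier → Carrier → ℕ → Carrier
  rhs a x y t u n =
    pow (- 1#) (n C 2) * pow a n * pow x (n C 2) * qfact t u n *
    prod (n ∸ 1) (λ m → prod m (λ i → 1# - a * pow x i * qnum x y (m ∸ i ℕ.+ 1)))

-- Number the pairs (p , q) by levels p + q = 0, …, n; level l occupies the positions
-- tri l, …, tri l + l.  A row of level l has its nonzero entries in levels l and l + 1, and
-- within level l it is bidiagonal.  Let H n j be the determinant of M_n without its first
-- column and without the row of offset j in level n; the theorem is about H n n.  Since the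
-- level-n rows vanish outside level n, a Laplace expansion along the rows of lower levels,
-- followed by an expansion of each upper factor along its last column, writes H n j as an
-- alternating sum over k of (∑_o ± entry · H (n−1) o) times the minors of the bidiagonal
-- level-n block.  The recurrence is solved by
--   H n j = ± W j (n−j) a^n [n]_{t,u}! ∏_{m<n} ∏_{i≤m} (1 − a x^i [m−i+1]_{x,y}),
-- where the weights W satisfy the exchange relation x^p [s+1] W p (s+1) = y^s [p+1] W (p+1) s,
-- which makes the alternating sums telescope; finally W n 0 = x^{C(n,2)}.
module Submission where

open import Defs
open import Level using (Level; _⊔_)
open import Data.Nat using (ℕ; _≤_)
open import Algebra.Bundles using (CommutativeRing)

open import Data.Nat as ℕ using (zero; suc; _<_; _∸_; z≤n; s≤s; _≡ᵇ_; _<ᵇ_)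
import Data.Nat.Properties as ℕP
import Data.Nat.Combinatorics as ℕC
open import Data.Nat.Tactic.RingSolver using (solve-∀)
open import Data.Fin as F using (Fin; toℕ; punchIn)
import Data.Fin.Properties as FP
import Data.Integer as ℤ
import Data.Integer.Properties as ℤP
import Data.Sign as Sign
open import Data.Integer using (ℤ; +_; -[1+_]; _⊖_; _◃_; ∣_∣)
open import Data.Bool using (Bool; true; false; if_then_else_; _∧_; _∨_)
open import Data.Maybe using (Maybe; just; nothing)
open import Data.Product using (_,_)
open import Data.Sum using (inj₁; inj₂)
open import Data.Empty using (⊥-elim)
open import Relation.Nullary using (yes; no)
open import Relation.Binary.PropositionalEquality as Eq using (_≡_; _≢_)
import Algebra.Properties.Ring as RingProperties
import Algebra.Solver.Ring
open import Algebra.Solver.Ring.AlmostCommutativeRing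
  using (AlmostCommutativeRing; _-Raw-AlmostCommutative⟶_; fromCommutativeRing)

-- Index arithmetic

skip : ℕ → ℕ → ℕ
skip zero i = suc i
skip (suc r) zero = zero
skip (suc r) (suc i) = suc (skip r i)

skip-< : ∀ {k} r i → r ≤ k → i < k → skip r i < suc k
skip-< zero i _ i<k = s≤s i<k
skip-< (suc r) zero _ _ = s≤s z≤n
skip-< (suc r) (suc i) (s≤s r≤k) (s≤s i<k) = s≤s (skip-< r i r≤k i<k)

skip-≤ : ∀ r i → skip r i ≤ suc i
skip-≤ zero i = ℕP.≤-refl
skip-≤ (suc r) zero = z≤n
skip-≤ (suc r) (suc i) = s≤s (skip-≤ r i)

skip-below : ∀ r i → i < r → skip r i ≡ i
skip-below (suc r) zero _ = Eq.refl
skip-below (suc r) (suc i) (s≤s i<r) = Eq.cong suc (skip-below r i i<r)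

skip-above : ∀ r i → r ≤ i → skip r i ≡ suc i
skip-above zero i _ = Eq.refl
skip-above (suc r) (suc i) (s≤s r≤i) = Eq.cong suc (skip-above r i r≤i)

skip-+ : ∀ m r i → skip (m ℕ.+ r) (m ℕ.+ i) ≡ m ℕ.+ skip r i
skip-+ zero r i = Eq.refl
skip-+ (suc m) r i = Eq.cong suc (skip-+ m r i)

-- The columns 0 … p−1 followed by the column p + k.
prefixThen : ℕ → ℕ → ℕ → ℕ
prefixThen zero k c = k
prefixThen (suc p) k zero = zero
prefixThen (suc p) k (suc c) = suc (prefixThen p k c)

prefixThen-< : ∀ p k c → c < p → prefixThen p k c ≡ c
prefixThen-< (suc p) k zero _ = Eq.refl
prefixThen-< (suc p) k (suc c) (s≤s c<p) = Eq.cong suc (prefixThen-< p k c c<p)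

prefixThen-last : ∀ p k → prefixThen p k p ≡ p ℕ.+ k
prefixThen-last zero k = Eq.refl
prefixThen-last (suc p) k = Eq.cong suc (prefixThen-last p k)

prefixThen-skip : ∀ p k j c → j ≤ p → c ≤ p →
                  prefixThen (suc p) k (skip j c) ≡ skip j (prefixThen p k c)
prefixThen-skip p k zero c _ _ = Eq.refl
prefixThen-skip (suc p) k (suc j) zero _ _ = Eq.refl
prefixThen-skip (suc p) k (suc j) (suc c) (s≤s j≤p) (s≤s c≤p) =
  Eq.cong suc (prefixThen-skip p k j c j≤p c≤p)

≡ᵇ-refl : ∀ n → (n ≡ᵇ n) ≡ true
≡ᵇ-refl zero = Eq.refl
≡ᵇ-refl (suc n) = ≡ᵇ-refl n

≡ᵇ-≢ : ∀ m n → m ≢ n → (m ≡ᵇ n) ≡ false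
≡ᵇ-≢ zero zero m≢n = ⊥-elim (m≢n Eq.refl)
≡ᵇ-≢ zero (suc n) _ = Eq.refl
≡ᵇ-≢ (suc m) zero _ = Eq.refl
≡ᵇ-≢ (suc m) (suc n) m≢n = ≡ᵇ-≢ m n (λ e → m≢n (Eq.cong suc e))

<ᵇ-< : ∀ m n → m < n → (m <ᵇ n) ≡ true
<ᵇ-< zero (suc n) _ = Eq.refl
<ᵇ-< (suc m) (suc n) (s≤s m<n) = <ᵇ-< m n m<n

<ᵇ-≥ : ∀ m n → n ≤ m → (m <ᵇ n) ≡ false
<ᵇ-≥ m zero _ = Eq.refl
<ᵇ-≥ (suc m) (suc n) (s≤s n≤m) = <ᵇ-≥ m n n≤m

C2-suc : ∀ n → suc n ℕC.C 2 ≡ n ℕ.+ n ℕC.C 2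
C2-suc n = Eq.trans (Eq.sym (ℕC.nCk+nC[k+1]≡[n+1]C[k+1] n 1)) (Eq.cong (ℕ._+ n ℕC.C 2) (ℕC.nC1≡n n))

tri-mono : ∀ {m n} → m ≤ n → tri m ≤ tri n
tri-mono {zero} _ = z≤n
tri-mono {suc m} {suc n} (s≤s m≤n) = ℕP.+-mono-≤ (s≤s m≤n) (tri-mono m≤n)

tri-≥ : ∀ l → l ≤ tri l
tri-≥ zero = z≤n
tri-≥ (suc l) = s≤s (ℕP.m≤m+n l (tri l))

record Position (i : ℕ) : Set where
  constructor position
  field
    level offset : ℕ
    offset≤level : offset ≤ level
    index : i ≡ tri level ℕ.+ offset

position-of : ∀ i → Position i
position-of zero = position 0 0 z≤n Eq.refl
position-of (suc i) with position-of i
... | position l o o≤l e with ℕP.m≤n⇒m<n∨m≡n o≤l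
...   | inj₁ o<l = position l (suc o) o<l (Eq.trans (Eq.cong suc e) (Eq.sym (ℕP.+-suc (tri l) o)))
...   | inj₂ Eq.refl = position (suc o) 0 z≤n
        (Eq.trans (Eq.cong suc (Eq.trans e (ℕP.+-comm (tri o) o))) (Eq.sym (ℕP.+-identityʳ _)))

level-< : ∀ l o L → o ≤ l → tri l ℕ.+ o < tri L → l < L
level-< l o L o≤l i<triL with l ℕ.<? L
... | yes l<L = l<L
... | no l≮L = ⊥-elim (ℕP.<-irrefl Eq.refl
        (ℕP.<-≤-trans i<triL (ℕP.≤-trans (tri-mono (ℕP.≮⇒≥ l≮L)) (ℕP.m≤m+n (tri l) o))))

tri' : ℕ → ℕ → ℕ
tri' l zero = 0
tri' l (suc d) = suc l ℕ.+ tri' (suc l) d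

tri'-tri : ∀ d l → tri' l d ℕ.+ tri l ≡ tri (d ℕ.+ l)
tri'-tri zero l = Eq.refl
tri'-tri (suc d) l =
  Eq.trans (Eq.cong (ℕ._+ tri l) (ℕP.+-comm (suc l) (tri' (suc l) d)))
  (Eq.trans (ℕP.+-assoc (tri' (suc l) d) (suc l) (tri l))
  (Eq.trans (tri'-tri d (suc l)) (Eq.cong tri (ℕP.+-suc d l))))

decodeGo-tri' : ∀ d l o f → o ≤ d ℕ.+ l → d ≤ f →
                decodeGo (suc f) (suc l) (tri' l d ℕ.+ suc o) ≡ (suc (d ℕ.+ l) , suc o)
decodeGo-tri' zero l o f o≤l _ rewrite <ᵇ-< o (suc l) (s≤s o≤l) = Eq.refl
decodeGo-tri' (suc d) l o (suc f) o≤ (s≤s d≤f)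
  rewrite <ᵇ-≥ (l ℕ.+ tri' (suc l) d ℕ.+ suc o) (suc l)
            (ℕP.≤-trans (ℕP.≤-reflexive (ℕP.+-comm 1 l))
                        (ℕP.+-mono-≤ (ℕP.m≤m+n l (tri' (suc l) d)) (s≤s z≤n)))
  = Eq.trans (Eq.cong (decodeGo (suc f) (suc (suc l))) drop-level)
      (Eq.trans (decodeGo-tri' d (suc l) o f (ℕP.≤-trans o≤ (ℕP.≤-reflexive (Eq.sym (ℕP.+-suc d l)))) d≤f)
                (Eq.cong (λ z → (suc z , suc o)) (ℕP.+-suc d l)))
  where
  drop-level : (suc l ℕ.+ tri' (suc l) d ℕ.+ suc o) ∸ suc l ≡ tri' (suc l) d ℕ.+ suc o
  drop-level = Eq.trans (Eq.cong (_∸ suc l) (ℕP.+-assoc (suc l) (tri' (suc l) d) (suc o)))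
                        (ℕP.m+n∸m≡n (suc l) _)

decode-tri : ∀ l o → o ≤ l → decode (suc (tri l ℕ.+ o)) ≡ (suc l , suc o)
decode-tri l o o≤l = Eq.trans (Eq.cong (decodeGo (suc (tri l ℕ.+ o)) 1) as-tri')
  (Eq.trans (decodeGo-tri' l 0 o (tri l ℕ.+ o) (ℕP.≤-trans o≤l (ℕP.≤-reflexive (Eq.sym (ℕP.+-identityʳ l))))
              (ℕP.≤-trans (tri-≥ l) (ℕP.m≤m+n _ o)))
            (Eq.cong (λ z → (suc z , suc o)) (ℕP.+-identityʳ l)))
  where
  tri'0 : tri' 0 l ≡ tri l
  tri'0 = Eq.trans (Eq.sym (ℕP.+-identityʳ (tri' 0 l))) (Eq.trans (tri'-tri l 0) (Eq.cong tri (ℕP.+-identityʳ l)))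
  as-tri' : suc (tri l ℕ.+ o) ≡ tri' 0 l ℕ.+ suc o
  as-tri' = Eq.trans (Eq.sym (ℕP.+-suc (tri l) o)) (Eq.cong (ℕ._+ suc o) (Eq.sym tri'0))

-- Integer coefficients make coefficient equality decidable, so the ring solver can cancel.
module IntegerCoefficients {c ℓ : Level} (R : CommutativeRing c ℓ) where
  open CommutativeRing R hiding (zero)
  open RingProperties ring using (-0#≈0#; -‿+-comm; -‿involutive; -1*x≈-x)
  open import Relation.Binary.Reasoning.Setoid setoid

  fromℕ : ℕ → Carrier
  fromℕ zero = 0#
  fromℕ (suc zero) = 1#
  fromℕ (suc (suc n)) = 1# + fromℕ (suc n)

  fromℕ-suc : ∀ n → fromℕ (suc n) ≈ 1# + fromℕ n
  fromℕ-suc zero = sym (+-identityʳ 1#)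
  fromℕ-suc (suc n) = refl

  fromℕ-+ : ∀ m n → fromℕ (m ℕ.+ n) ≈ fromℕ m + fromℕ n
  fromℕ-+ zero n = sym (+-identityˡ _)
  fromℕ-+ (suc m) n = begin
    fromℕ (suc (m ℕ.+ n))    ≈⟨ fromℕ-suc (m ℕ.+ n) ⟩
    1# + fromℕ (m ℕ.+ n)     ≈⟨ +-congˡ (fromℕ-+ m n) ⟩
    1# + (fromℕ m + fromℕ n) ≈⟨ +-assoc _ _ _ ⟨
    (1# + fromℕ m) + fromℕ n ≈⟨ +-congʳ (fromℕ-suc m) ⟨
    fromℕ (suc m) + fromℕ n  ∎

  fromℕ-* : ∀ m n → fromℕ (m ℕ.* n) ≈ fromℕ m * fromℕ n
  fromℕ-* zero n = sym (zeroˡ _)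
  fromℕ-* (suc m) n = begin
    fromℕ (n ℕ.+ m ℕ.* n)             ≈⟨ fromℕ-+ n (m ℕ.* n) ⟩
    fromℕ n + fromℕ (m ℕ.* n)         ≈⟨ +-cong (sym (*-identityˡ _)) (fromℕ-* m n) ⟩
    1# * fromℕ n + fromℕ m * fromℕ n  ≈⟨ distribʳ _ _ _ ⟨
    (1# + fromℕ m) * fromℕ n          ≈⟨ *-congʳ (fromℕ-suc m) ⟨
    fromℕ (suc m) * fromℕ n           ∎

  fromℤ : ℤ → Carrier
  fromℤ (+ n) = fromℕ n
  fromℤ -[1+ n ] = - fromℕ (suc n)

  fromℤ-⊖ : ∀ m n → fromℤ (m ⊖ n) ≈ fromℕ m - fromℕ n
  fromℤ-⊖ m zero = sym (trans (+-congˡ -0#≈0#) (+-identityʳ _))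
  fromℤ-⊖ zero (suc n) = sym (+-identityˡ _)
  fromℤ-⊖ (suc m) (suc n) = begin
    fromℤ (suc m ⊖ suc n)                 ≡⟨ Eq.cong fromℤ (ℤP.[1+m]⊖[1+n]≡m⊖n m n) ⟩
    fromℤ (m ⊖ n)                         ≈⟨ fromℤ-⊖ m n ⟩
    fromℕ m - fromℕ n                     ≈⟨ cancel-1# ⟨
    (1# + fromℕ m) - (1# + fromℕ n)       ≈⟨ +-cong (fromℕ-suc m) (-‿cong (fromℕ-suc n)) ⟨
    fromℕ (suc m) - fromℕ (suc n)         ∎
    where
    cancel-1# : (1# + fromℕ m) - (1# + fromℕ n) ≈ fromℕ m - fromℕ n
    cancel-1# = begin
      (1# + fromℕ m) + - (1# + fromℕ n)       ≈⟨ +-congˡ (-‿+-comm 1# _) ⟨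
      (1# + fromℕ m) + (- 1# + - fromℕ n)     ≈⟨ +-assoc _ _ _ ⟩
      1# + (fromℕ m + (- 1# + - fromℕ n))
        ≈⟨ +-congˡ (trans (sym (+-assoc _ _ _)) (trans (+-congʳ (+-comm _ _)) (+-assoc _ _ _))) ⟩
      1# + (- 1# + (fromℕ m - fromℕ n))       ≈⟨ +-assoc _ _ _ ⟨
      (1# - 1#) + (fromℕ m - fromℕ n)         ≈⟨ +-congʳ (-‿inverseʳ 1#) ⟩
      0# + (fromℕ m - fromℕ n)                ≈⟨ +-identityˡ _ ⟩
      fromℕ m - fromℕ n                       ∎

  fromℤ-+ : ∀ i j → fromℤ (i ℤ.+ j) ≈ fromℤ i + fromℤ j
  fromℤ-+ -[1+ m ] -[1+ n ] = begin
    - fromℕ (suc (suc (m ℕ.+ n)))       ≡⟨ Eq.cong (λ z → - fromℕ (suc z)) (Eq.sym (ℕP.+-suc m n)) ⟩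
    - fromℕ (suc m ℕ.+ suc n)           ≈⟨ -‿cong (fromℕ-+ (suc m) (suc n)) ⟩
    - (fromℕ (suc m) + fromℕ (suc n))   ≈⟨ -‿+-comm _ _ ⟨
    - fromℕ (suc m) + - fromℕ (suc n)   ∎
  fromℤ-+ -[1+ m ] (+ n) = trans (fromℤ-⊖ n (suc m)) (+-comm _ _)
  fromℤ-+ (+ m) -[1+ n ] = fromℤ-⊖ m (suc n)
  fromℤ-+ (+ m) (+ n) = fromℕ-+ m n

  fromℤ-neg : ∀ i → fromℤ (ℤ.- i) ≈ - fromℤ i
  fromℤ-neg -[1+ n ] = sym (-‿involutive _)
  fromℤ-neg (+ zero) = sym -0#≈0#
  fromℤ-neg (+ suc n) = refl

  fromSign : Sign.Sign → Carrier
  fromSign Sign.+ = 1#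
  fromSign Sign.- = - 1#

  fromSign-* : ∀ s t → fromSign (s Sign.* t) ≈ fromSign s * fromSign t
  fromSign-* Sign.+ Sign.+ = sym (*-identityˡ _)
  fromSign-* Sign.+ Sign.- = sym (*-identityˡ _)
  fromSign-* Sign.- Sign.+ = sym (*-identityʳ _)
  fromSign-* Sign.- Sign.- = sym (trans (-1*x≈-x _) (-‿involutive _))

  fromℤ-◃ : ∀ s n → fromℤ (s ◃ n) ≈ fromSign s * fromℕ n
  fromℤ-◃ s zero = sym (zeroʳ _)
  fromℤ-◃ Sign.+ (suc n) = sym (*-identityˡ _)
  fromℤ-◃ Sign.- (suc n) = sym (-1*x≈-x _)

  fromℤ-sign-abs : ∀ i → fromℤ i ≈ fromSign (ℤ.sign i) * fromℕ ∣ i ∣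
  fromℤ-sign-abs (+ n) = sym (*-identityˡ _)
  fromℤ-sign-abs -[1+ n ] = sym (-1*x≈-x _)

  *-interchange : ∀ p q r s → (p * q) * (r * s) ≈ (p * r) * (q * s)
  *-interchange p q r s = begin
    (p * q) * (r * s)  ≈⟨ *-assoc _ _ _ ⟩
    p * (q * (r * s))  ≈⟨ *-congˡ (trans (sym (*-assoc _ _ _)) (*-congʳ (*-comm q r))) ⟩
    p * ((r * q) * s)  ≈⟨ *-congˡ (*-assoc _ _ _) ⟩
    p * (r * (q * s))  ≈⟨ *-assoc _ _ _ ⟨
    (p * r) * (q * s)  ∎

  fromℤ-* : ∀ i j → fromℤ (i ℤ.* j) ≈ fromℤ i * fromℤ j
  fromℤ-* i j = begin
    fromℤ (i ℤ.* j)
      ≈⟨ fromℤ-◃ (ℤ.sign i Sign.* ℤ.sign j) (∣ i ∣ ℕ.* ∣ j ∣) ⟩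
    fromSign (ℤ.sign i Sign.* ℤ.sign j) * fromℕ (∣ i ∣ ℕ.* ∣ j ∣)
      ≈⟨ *-cong (fromSign-* (ℤ.sign i) (ℤ.sign j)) (fromℕ-* ∣ i ∣ ∣ j ∣) ⟩
    (fromSign (ℤ.sign i) * fromSign (ℤ.sign j)) * (fromℕ ∣ i ∣ * fromℕ ∣ j ∣)
      ≈⟨ *-interchange _ _ _ _ ⟩
    (fromSign (ℤ.sign i) * fromℕ ∣ i ∣) * (fromSign (ℤ.sign j) * fromℕ ∣ j ∣)
      ≈⟨ *-cong (fromℤ-sign-abs i) (fromℤ-sign-abs j) ⟨
    fromℤ i * fromℤ j ∎

  almostCommutativeRing : AlmostCommutativeRing c ℓ
  almostCommutativeRing = fromCommutativeRing R

  fromℤ-homomorphism : ℤ.+-*-rawRing -Raw-AlmostCommutative⟶ almostCommutativeRing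
  fromℤ-homomorphism = record
    { ⟦_⟧ = fromℤ ; +-homo = fromℤ-+ ; *-homo = fromℤ-* ; -‿homo = fromℤ-neg
    ; 0-homo = refl ; 1-homo = refl }

  fromℤ-≟ : ∀ i j → Maybe (fromℤ i ≈ fromℤ j)
  fromℤ-≟ i j with i ℤ.≟ j
  ... | yes Eq.refl = just refl
  ... | no _ = nothing

  open Algebra.Solver.Ring ℤ.+-*-rawRing almostCommutativeRing fromℤ-homomorphism fromℤ-≟ public

-- Determinants of matrices indexed by ℕ

module Determinants {c ℓ : Level} (R : CommutativeRing c ℓ) where
  open CommutativeRing R hiding (zero)
  open WithRing R using (pow; sumFin; det; minor)
  open RingProperties ring using (-1*x≈-x; -‿involutive)
  open IntegerCoefficients R using (solve; _:=_; _:+_; _:*_)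
  open import Relation.Binary.Reasoning.Setoid setoid

  -- Opaque, so that unification never unfolds sums.
  opaque
    ∑ : ℕ → (ℕ → Carrier) → Carrier
    ∑ zero f = 0#
    ∑ (suc k) f = f 0 + ∑ k (λ i → f (suc i))

  opaque
    unfolding ∑

    ∑-0 : ∀ (f : ℕ → Carrier) → ∑ 0 f ≡ 0#
    ∑-0 f = Eq.refl

    ∑-suc : ∀ k (f : ℕ → Carrier) → ∑ (suc k) f ≡ f 0 + ∑ k (λ i → f (suc i))
    ∑-suc k f = Eq.refl

    ∑-1 : ∀ (f : ℕ → Carrier) → ∑ 1 f ≈ f 0
    ∑-1 f = +-identityʳ _

    ∑-cong : ∀ k {f g : ℕ → Carrier} → (∀ i → i < k → f i ≈ g i) → ∑ k f ≈ ∑ k g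
    ∑-cong zero f≈g = refl
    ∑-cong (suc k) f≈g = +-cong (f≈g 0 (s≤s z≤n)) (∑-cong k (λ i i<k → f≈g (suc i) (s≤s i<k)))

    ∑-zero : ∀ k (f : ℕ → Carrier) → (∀ i → i < k → f i ≈ 0#) → ∑ k f ≈ 0#
    ∑-zero zero f f≈0 = refl
    ∑-zero (suc k) f f≈0 =
      trans (+-cong (f≈0 0 (s≤s z≤n)) (∑-zero k (λ i → f (suc i)) (λ i i<k → f≈0 (suc i) (s≤s i<k))))
            (+-identityˡ 0#)

    ∑-+ : ∀ k (f g : ℕ → Carrier) → ∑ k (λ i → f i + g i) ≈ ∑ k f + ∑ k g
    ∑-+ zero f g = sym (+-identityˡ 0#)
    ∑-+ (suc k) f g = begin
      (f 0 + g 0) + ∑ k (λ i → f (suc i) + g (suc i))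
        ≈⟨ +-congˡ (∑-+ k (λ i → f (suc i)) (λ i → g (suc i))) ⟩
      (f 0 + g 0) + (∑ k (λ i → f (suc i)) + ∑ k (λ i → g (suc i)))
        ≈⟨ +-interchange (f 0) (g 0) _ _ ⟩
      (f 0 + ∑ k (λ i → f (suc i))) + (g 0 + ∑ k (λ i → g (suc i))) ∎
      where
      +-interchange : ∀ p q r s → (p + q) + (r + s) ≈ (p + r) + (q + s)
      +-interchange = solve 4 (λ p q r s → (p :+ q) :+ (r :+ s) := (p :+ r) :+ (q :+ s)) refl

    ∑-*ˡ : ∀ k (a : Carrier) (f : ℕ → Carrier) → ∑ k (λ i → a * f i) ≈ a * ∑ k f
    ∑-*ˡ zero a f = sym (zeroʳ a)
    ∑-*ˡ (suc k) a f = trans (+-congˡ (∑-*ˡ k a (λ i → f (suc i)))) (sym (distribˡ a _ _))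

    ∑-split : ∀ m k (f : ℕ → Carrier) → ∑ (m ℕ.+ k) f ≈ ∑ m f + ∑ k (λ i → f (m ℕ.+ i))
    ∑-split zero k f = sym (+-identityˡ _)
    ∑-split (suc m) k f = trans (+-congˡ (∑-split m k (λ i → f (suc i)))) (sym (+-assoc _ _ _))

    ∑-single : ∀ k i (f : ℕ → Carrier) → i < k → (∀ j → j < k → j ≢ i → f j ≈ 0#) → ∑ k f ≈ f i
    ∑-single (suc k) zero f _ f≈0 =
      trans (+-congˡ (∑-zero k (λ j → f (suc j)) (λ j j<k → f≈0 (suc j) (s≤s j<k) (λ ()))))
            (+-identityʳ _)
    ∑-single (suc k) (suc i) f (s≤s i<k) f≈0 =
      trans (+-cong (f≈0 0 (s≤s z≤n) (λ ()))
                    (∑-single k i (λ j → f (suc j)) i<k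
                       (λ j j<k j≢i → f≈0 (suc j) (s≤s j<k) (λ e → j≢i (ℕP.suc-injective e)))))
            (+-identityˡ _)

    ∑-pair : ∀ k i (f : ℕ → Carrier) → suc i < k → (∀ j → j < k → j ≢ i → j ≢ suc i → f j ≈ 0#) →
             ∑ k f ≈ f i + f (suc i)
    ∑-pair (suc k) zero f i<k f≈0 =
      +-congˡ (∑-single k 0 (λ j → f (suc j)) (ℕP.≤-pred i<k)
                 (λ j j<k j≢0 → f≈0 (suc j) (s≤s j<k) (λ ()) (λ e → j≢0 (ℕP.suc-injective e))))
    ∑-pair (suc k) (suc i) f (s≤s i<k) f≈0 =
      trans (+-cong (f≈0 0 (s≤s z≤n) (λ ()) (λ ()))
                    (∑-pair k i (λ j → f (suc j)) i<k
                       (λ j j<k j≢i j≢si → f≈0 (suc j) (s≤s j<k) (λ e → j≢i (ℕP.suc-injective e))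
                                                                (λ e → j≢si (ℕP.suc-injective e)))))
            (+-identityˡ _)

  ∑-*ʳ : ∀ k (a : Carrier) (f : ℕ → Carrier) → ∑ k (λ i → f i * a) ≈ ∑ k f * a
  ∑-*ʳ k a f = begin
    ∑ k (λ i → f i * a) ≈⟨ ∑-cong k (λ i _ → *-comm (f i) a) ⟩
    ∑ k (λ i → a * f i) ≈⟨ ∑-*ˡ k a f ⟩
    a * ∑ k f           ≈⟨ *-comm a _ ⟩
    ∑ k f * a           ∎

  ∑-*ˡ² : ∀ k (a b : Carrier) (f : ℕ → Carrier) → a * (b * ∑ k f) ≈ ∑ k (λ i → a * (b * f i))
  ∑-*ˡ² k a b f = trans (*-congˡ (sym (∑-*ˡ k b f))) (sym (∑-*ˡ k a (λ i → b * f i)))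

  ∑-last : ∀ k (f : ℕ → Carrier) → ∑ (suc k) f ≈ ∑ k f + f k
  ∑-last k f = begin
    ∑ (suc k) f                ≡⟨ Eq.cong (λ z → ∑ z f) (ℕP.+-comm 1 k) ⟩
    ∑ (k ℕ.+ 1) f              ≈⟨ ∑-split k 1 f ⟩
    ∑ k f + ∑ 1 (λ i → f (k ℕ.+ i)) ≈⟨ +-congˡ (∑-1 _) ⟩
    ∑ k f + f (k ℕ.+ 0)        ≡⟨ Eq.cong (λ z → ∑ k f + f z) (ℕP.+-identityʳ k) ⟩
    ∑ k f + f k                ∎

  ∑-swap : ∀ m k (f : ℕ → ℕ → Carrier) → ∑ m (λ i → ∑ k (f i)) ≈ ∑ k (λ j → ∑ m (λ i → f i j))
  ∑-swap zero k f = begin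
    ∑ 0 (λ i → ∑ k (f i))  ≡⟨ ∑-0 _ ⟩
    0#                     ≈⟨ ∑-zero k _ (λ j _ → reflexive (∑-0 _)) ⟨
    ∑ k (λ j → ∑ 0 (λ i → f i j)) ∎
  ∑-swap (suc m) k f = begin
    ∑ (suc m) (λ i → ∑ k (f i))
      ≡⟨ ∑-suc m _ ⟩
    ∑ k (f 0) + ∑ m (λ i → ∑ k (f (suc i)))
      ≈⟨ +-congˡ (∑-swap m k (λ i → f (suc i))) ⟩
    ∑ k (f 0) + ∑ k (λ j → ∑ m (λ i → f (suc i) j))
      ≈⟨ ∑-+ k _ _ ⟨
    ∑ k (λ j → f 0 j + ∑ m (λ i → f (suc i) j))
      ≈⟨ ∑-cong k (λ j _ → reflexive (Eq.sym (∑-suc m (λ i → f i j)))) ⟩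
    ∑ k (λ j → ∑ (suc m) (λ i → f i j)) ∎

  *-zeroᵐ : ∀ p {q} r → q ≈ 0# → p * (q * r) ≈ 0#
  *-zeroᵐ p r q≈0 = trans (*-congˡ (trans (*-congʳ q≈0) (zeroˡ r))) (zeroʳ p)

  *-zeroʳ² : ∀ p q {r} → r ≈ 0# → p * (q * r) ≈ 0#
  *-zeroʳ² p q r≈0 = trans (*-congˡ (trans (*-congˡ r≈0) (zeroʳ q))) (zeroʳ p)

  sgn : ℕ → Carrier
  sgn = pow (- 1#)

  sgn-suc : ∀ k → sgn (suc k) ≈ - sgn k
  sgn-suc k = -1*x≈-x (sgn k)

  sgn-2+ : ∀ k → sgn (suc (suc k)) ≈ sgn k
  sgn-2+ k = trans (sgn-suc (suc k)) (trans (-‿cong (sgn-suc k)) (-‿involutive (sgn k)))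

  pow-+ : ∀ (z : Carrier) m k → pow z (m ℕ.+ k) ≈ pow z m * pow z k
  pow-+ z zero k = sym (*-identityˡ _)
  pow-+ z (suc m) k = trans (*-congˡ (pow-+ z m k)) (sym (*-assoc _ _ _))

  sgn-+ : ∀ m k → sgn (m ℕ.+ k) ≈ sgn m * sgn k
  sgn-+ = pow-+ (- 1#)

  sgn-double : ∀ k → sgn (k ℕ.+ k) ≈ 1#
  sgn-double zero = refl
  sgn-double (suc k) = begin
    sgn (suc (k ℕ.+ suc k))   ≡⟨ Eq.cong (λ z → sgn (suc z)) (ℕP.+-suc k k) ⟩
    sgn (suc (suc (k ℕ.+ k))) ≈⟨ sgn-2+ (k ℕ.+ k) ⟩
    sgn (k ℕ.+ k)             ≈⟨ sgn-double k ⟩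
    1#                        ∎

  sgn-+double : ∀ m k → sgn (m ℕ.+ (k ℕ.+ k)) ≈ sgn m
  sgn-+double m k = trans (sgn-+ m (k ℕ.+ k)) (trans (*-congˡ (sgn-double k)) (*-identityʳ _))

  Matrix : Set c
  Matrix = ℕ → ℕ → Carrier

  minorℕ : Matrix → ℕ → ℕ → Matrix
  minorℕ A r c i j = A (skip r i) (skip c j)

  detℕ : ℕ → Matrix → Carrier
  detℕ zero A = 1#
  detℕ (suc k) A = ∑ (suc k) (λ j → sgn j * (A 0 j * detℕ k (minorℕ A 0 j)))

  detℕ-cong : ∀ k {A B : Matrix} → (∀ i j → i < k → j < k → A i j ≈ B i j) → detℕ k A ≈ detℕ k B
  detℕ-cong zero A≈B = refl
  detℕ-cong (suc k) A≈B = ∑-cong (suc k) λ j j<k →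
    *-congˡ {sgn j} (*-cong (A≈B 0 j (s≤s z≤n) j<k)
      (detℕ-cong k (λ i l i<k l<k → A≈B (suc i) (skip j l) (s≤s i<k) (skip-< j l (ℕP.≤-pred j<k) l<k))))

  detℕ-1 : ∀ (A : Matrix) → detℕ 1 A ≈ A 0 0
  detℕ-1 A = trans (∑-1 _) (trans (*-identityˡ _) (*-identityʳ _))

  toℕ-punchIn : ∀ {k} (r : Fin (suc k)) (i : Fin k) → toℕ (punchIn r i) ≡ skip (toℕ r) (toℕ i)
  toℕ-punchIn F.zero i = Eq.refl
  toℕ-punchIn (F.suc r) F.zero = Eq.refl
  toℕ-punchIn (F.suc r) (F.suc i) = Eq.cong suc (toℕ-punchIn r i)

  sumFin-cong : ∀ k {f g : Fin k → Carrier} → (∀ i → f i ≈ g i) → sumFin k f ≈ sumFin k g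
  sumFin-cong zero f≈g = refl
  sumFin-cong (suc k) f≈g = +-cong (f≈g F.zero) (sumFin-cong k (λ i → f≈g (F.suc i)))

  sumFin≈∑ : ∀ k (g : ℕ → Carrier) → sumFin k (λ j → g (toℕ j)) ≈ ∑ k g
  sumFin≈∑ zero g = sym (reflexive (∑-0 g))
  sumFin≈∑ (suc k) g = trans (+-congˡ (sumFin≈∑ k (λ i → g (suc i)))) (sym (reflexive (∑-suc k g)))

  det-cong : ∀ k {B B′ : Fin k → Fin k → Carrier} → (∀ i j → B i j ≈ B′ i j) → det k B ≈ det k B′
  det-cong zero B≈B′ = refl
  det-cong (suc k) B≈B′ = sumFin-cong (suc k) λ j →
    *-congˡ {sgn (toℕ j)} (*-cong (B≈B′ F.zero j) (det-cong k (λ i l → B≈B′ (punchIn F.zero i) (punchIn j l))))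

  det≈detℕ : ∀ k (A : Matrix) → det k (λ r s → A (toℕ r) (toℕ s)) ≈ detℕ k A
  det≈detℕ zero A = refl
  det≈detℕ (suc k) A = begin
    det (suc k) (λ r s → A (toℕ r) (toℕ s))
      ≈⟨ sumFin-cong (suc k) (λ j → *-congˡ {sgn (toℕ j)} (*-congˡ {A 0 (toℕ j)} (minor≈ j))) ⟩
    sumFin (suc k) (λ j → sgn (toℕ j) * (A 0 (toℕ j) * detℕ k (minorℕ A 0 (toℕ j))))
      ≈⟨ sumFin≈∑ (suc k) (λ j → sgn j * (A 0 j * detℕ k (minorℕ A 0 j))) ⟩
    detℕ (suc k) A ∎
    where
    minor≈ : ∀ j → det k (minor (λ r s → A (toℕ r) (toℕ s)) F.zero j) ≈ detℕ k (minorℕ A 0 (toℕ j))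
    minor≈ j = trans (det-cong k (λ i l → reflexive (Eq.cong (A (suc (toℕ i))) (toℕ-punchIn j l))))
                     (det≈detℕ k (minorℕ A 0 (toℕ j)))

  detℕ-zeroColumn : ∀ k (A : Matrix) → (∀ r → r < suc k → A r 0 ≈ 0#) → detℕ (suc k) A ≈ 0#
  detℕ-zeroColumn zero A A0≈0 = trans (∑-1 _) (*-zeroᵐ _ _ (A0≈0 0 (s≤s z≤n)))
  detℕ-zeroColumn (suc k) A A0≈0 = begin
    detℕ (suc (suc k)) A
      ≡⟨ ∑-suc (suc k) _ ⟩
    sgn 0 * (A 0 0 * _) + ∑ (suc k) (λ j → sgn (suc j) * (A 0 (suc j) * detℕ (suc k) (minorℕ A 0 (suc j))))
      ≈⟨ +-cong (*-zeroᵐ _ _ (A0≈0 0 (s≤s z≤n)))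
                (∑-zero (suc k) _ (λ j _ → *-zeroʳ² (sgn (suc j)) (A 0 (suc j))
                  (detℕ-zeroColumn k (minorℕ A 0 (suc j)) (λ r r<k → A0≈0 (suc r) (s≤s r<k))))) ⟩
    0# + 0# ≈⟨ +-identityˡ 0# ⟩
    0# ∎

  -- The first m + 1 columns vanish below row m, so they are linearly dependent.
  detℕ-zeroBlock : ∀ m s (A : Matrix) → (∀ r c → r < suc s → c < suc m → A (m ℕ.+ r) c ≈ 0#) →
                   detℕ (m ℕ.+ suc s) A ≈ 0#
  detℕ-zeroBlock zero s A A≈0 = detℕ-zeroColumn s A (λ r r<s → A≈0 r 0 r<s (s≤s z≤n))
  detℕ-zeroBlock (suc m) s A A≈0 = ∑-zero (suc (m ℕ.+ suc s)) _ λ j _ →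
    *-zeroʳ² (sgn j) (A 0 j) (detℕ-zeroBlock m s (minorℕ A 0 j)
      (λ r c r<s c<m → A≈0 r (skip j c) r<s (ℕP.≤-trans (s≤s (skip-≤ j c)) (s≤s c<m))))

  detℕ-blockTriangular : ∀ m q (A : Matrix) → (∀ r c → r < q → c < m → A (m ℕ.+ r) c ≈ 0#) →
    detℕ (m ℕ.+ q) A ≈ detℕ m A * detℕ q (λ r c → A (m ℕ.+ r) (m ℕ.+ c))
  detℕ-blockTriangular zero q A _ = sym (*-identityˡ _)
  detℕ-blockTriangular (suc m) q A A≈0 = begin
    ∑ (suc m ℕ.+ q) T
      ≈⟨ ∑-split (suc m) q T ⟩
    ∑ (suc m) T + ∑ q (λ k → T (suc m ℕ.+ k))
      ≈⟨ +-cong (∑-cong (suc m) (λ j j<m → *-congˡ {sgn j} (*-congˡ {A 0 j} (leading j j<m))))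
                (∑-zero q _ (λ k k<q → *-zeroʳ² (sgn (suc m ℕ.+ k)) (A 0 (suc m ℕ.+ k)) (trailing k k<q))) ⟩
    ∑ (suc m) (λ j → sgn j * (A 0 j * (detℕ m (minorℕ A 0 j) * D))) + 0#
      ≈⟨ +-identityʳ _ ⟩
    ∑ (suc m) (λ j → sgn j * (A 0 j * (detℕ m (minorℕ A 0 j) * D)))
      ≈⟨ ∑-cong (suc m) (λ j _ → *-assoc³ (sgn j) (A 0 j) (detℕ m (minorℕ A 0 j)) D) ⟩
    ∑ (suc m) (λ j → sgn j * (A 0 j * detℕ m (minorℕ A 0 j)) * D)
      ≈⟨ ∑-*ʳ (suc m) D _ ⟩
    detℕ (suc m) A * D ∎
    where
    D = detℕ q (λ r c → A (suc m ℕ.+ r) (suc m ℕ.+ c))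
    T : ℕ → Carrier
    T j = sgn j * (A 0 j * detℕ (m ℕ.+ q) (minorℕ A 0 j))
    *-assoc³ : ∀ p q r s → p * (q * (r * s)) ≈ p * (q * r) * s
    *-assoc³ = solve 4 (λ p q r s → p :* (q :* (r :* s)) := p :* (q :* r) :* s) refl
    leading : ∀ j → j < suc m → detℕ (m ℕ.+ q) (minorℕ A 0 j) ≈ detℕ m (minorℕ A 0 j) * D
    leading j j<m = trans (detℕ-blockTriangular m q (minorℕ A 0 j)
                            (λ r c r<q c<m → A≈0 r (skip j c) r<q (skip-< j c (ℕP.≤-pred j<m) c<m)))
                  (*-congˡ (detℕ-cong q (λ r c _ _ → reflexive (Eq.cong (A (suc m ℕ.+ r))
                     (skip-above j (m ℕ.+ c) (ℕP.≤-trans (ℕP.≤-pred j<m) (ℕP.m≤m+n m c)))))))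
    trailing : ∀ k → k < q → detℕ (m ℕ.+ q) (minorℕ A 0 (suc m ℕ.+ k)) ≈ 0#
    trailing k (s≤s {n = s} _) = detℕ-zeroBlock m s (minorℕ A 0 (suc m ℕ.+ k))
      (λ r c r<q c<m → trans (reflexive (Eq.cong (A (suc m ℕ.+ r))
                                    (skip-below (suc m ℕ.+ k) c (ℕP.≤-trans c<m (s≤s (ℕP.m≤m+n m k))))))
                             (A≈0 r c r<q c<m))

  detℕ-firstColumn : ∀ q (A : Matrix) → (∀ r → r < q → A (suc r) 0 ≈ 0#) →
                     detℕ (suc q) A ≈ A 0 0 * detℕ q (λ r c → A (suc r) (suc c))
  detℕ-firstColumn q A A≈0 =
    trans (detℕ-blockTriangular 1 q A (λ { r zero r<q _ → A≈0 r r<q ; r (suc c) _ (s≤s ()) }))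
          (*-congʳ (detℕ-1 A))

  detℕ-firstRow : ∀ k (A : Matrix) → (∀ c → c < k → A 0 (suc c) ≈ 0#) →
                  detℕ (suc k) A ≈ A 0 0 * detℕ k (minorℕ A 0 0)
  detℕ-firstRow k A A≈0 = begin
    detℕ (suc k) A
      ≡⟨ ∑-suc k _ ⟩
    sgn 0 * (A 0 0 * detℕ k (minorℕ A 0 0)) + ∑ k (λ j → sgn (suc j) * (A 0 (suc j) * detℕ k (minorℕ A 0 (suc j))))
      ≈⟨ +-cong (*-identityˡ _) (∑-zero k _ (λ j j<k → *-zeroᵐ _ _ (A≈0 j j<k))) ⟩
    A 0 0 * detℕ k (minorℕ A 0 0) + 0# ≈⟨ +-identityʳ _ ⟩
    A 0 0 * detℕ k (minorℕ A 0 0) ∎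

  -- Laplace expansion along the first p + 1 rows when the lower left q × p block vanishes:
  -- only the column sets {0 … p−1, p + k} contribute.
  detℕ-laplaceBlock : ∀ p q (A : Matrix) → (∀ r c → r < q → c < p → A (suc p ℕ.+ r) c ≈ 0#) →
    detℕ (p ℕ.+ suc q) A ≈
    ∑ (suc q) (λ k → sgn k * (detℕ (suc p) (λ r c → A r (prefixThen p k c)) *
                               detℕ q (λ r c → A (suc p ℕ.+ r) (p ℕ.+ skip k c))))
  detℕ-laplaceBlock zero q A _ =
    ∑-cong (suc q) (λ k _ → *-congˡ {sgn k} (*-congʳ (sym (detℕ-1 (λ r c → A r (prefixThen 0 k c))))))
  detℕ-laplaceBlock (suc p) q A A≈0 = begin
    ∑ (suc p ℕ.+ suc q) T
      ≈⟨ ∑-split (suc p) (suc q) T ⟩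
    ∑ (suc p) T + ∑ (suc q) (λ k → T (suc p ℕ.+ k))
      ≈⟨ +-cong (∑-cong (suc p) (λ j j<p → *-congˡ {sgn j} (*-congˡ {A 0 j} (leading j j<p))))
                (∑-cong (suc q) (λ k _ → trans (*-cong (sgn-+ (suc p) k) (*-congˡ {A 0 (suc p ℕ.+ k)} (trailing k)))
                                               (*-assoc _ _ _))) ⟩
    ∑ (suc p) (λ j → sgn j * (A 0 j * ∑ (suc q) (λ k → sgn k * (X j k * D k))))
      + ∑ (suc q) (λ k → sgn (suc p) * (sgn k * (A 0 (suc p ℕ.+ k) * (Y * D k))))
      ≈⟨ +-congʳ (trans (∑-cong (suc p) (λ j _ → ∑-*ˡ² (suc q) (sgn j) (A 0 j) _))
                        (∑-swap (suc p) (suc q) _)) ⟩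
    ∑ (suc q) (λ k → ∑ (suc p) (λ j → sgn j * (A 0 j * (sgn k * (X j k * D k)))))
      + ∑ (suc q) (λ k → sgn (suc p) * (sgn k * (A 0 (suc p ℕ.+ k) * (Y * D k))))
      ≈⟨ ∑-+ (suc q) _ _ ⟨
    ∑ (suc q) (λ k → ∑ (suc p) (λ j → sgn j * (A 0 j * (sgn k * (X j k * D k))))
                      + sgn (suc p) * (sgn k * (A 0 (suc p ℕ.+ k) * (Y * D k))))
      ≈⟨ ∑-cong (suc q) (λ k _ → sym (regroup k)) ⟩
    ∑ (suc q) (λ k → sgn k * (detℕ (suc (suc p)) (B k) * D k)) ∎
    where
    T : ℕ → Carrier
    T j = sgn j * (A 0 j * detℕ (p ℕ.+ suc q) (minorℕ A 0 j))
    B : ℕ → Matrix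
    B k r c = A r (prefixThen (suc p) k c)
    X : ℕ → ℕ → Carrier
    X j k = detℕ (suc p) (minorℕ (B k) 0 j)
    D : ℕ → Carrier
    D k = detℕ q (λ r c → A (suc (suc p) ℕ.+ r) (suc p ℕ.+ skip k c))
    Y : Carrier
    Y = detℕ (suc p) (λ r c → A (suc r) c)
    leading : ∀ j → j < suc p → detℕ (p ℕ.+ suc q) (minorℕ A 0 j) ≈ ∑ (suc q) (λ k → sgn k * (X j k * D k))
    leading j j<p = trans
      (detℕ-laplaceBlock p q (minorℕ A 0 j) (λ r c r<q c<p → A≈0 r (skip j c) r<q (skip-< j c (ℕP.≤-pred j<p) c<p)))
      (∑-cong (suc q) (λ k _ → *-congˡ {sgn k} (*-cong
        (detℕ-cong (suc p) (λ r c _ c<p → reflexive (Eq.cong (A (suc r))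
           (Eq.sym (prefixThen-skip p k j c (ℕP.≤-pred j<p) (ℕP.≤-pred c<p))))))
        (detℕ-cong q (λ r c _ _ → reflexive (Eq.cong (A (suc (suc p) ℕ.+ r))
           (skip-above j (p ℕ.+ skip k c) (ℕP.≤-trans (ℕP.≤-pred j<p) (ℕP.m≤m+n p _)))))))))
    skip-pk : ∀ k c → c < suc p → skip (suc p ℕ.+ k) c ≡ c
    skip-pk k c c<p = skip-below (suc p ℕ.+ k) c (ℕP.≤-trans c<p (s≤s (ℕP.m≤m+n p k)))
    trailing : ∀ k → detℕ (p ℕ.+ suc q) (minorℕ A 0 (suc p ℕ.+ k)) ≈ Y * D k
    trailing k = begin
      detℕ (p ℕ.+ suc q) M   ≡⟨ Eq.cong (λ z → detℕ z M) (ℕP.+-suc p q) ⟩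
      detℕ (suc p ℕ.+ q) M
        ≈⟨ detℕ-blockTriangular (suc p) q M (λ r c r<q c<p →
             trans (reflexive (Eq.cong (A (suc (suc p ℕ.+ r))) (skip-pk k c c<p))) (A≈0 r c r<q c<p)) ⟩
      detℕ (suc p) M * detℕ q (λ r c → M (suc p ℕ.+ r) (suc p ℕ.+ c))
        ≈⟨ *-cong (detℕ-cong (suc p) (λ r c _ c<p → reflexive (Eq.cong (A (suc r)) (skip-pk k c c<p))))
                  (detℕ-cong q (λ r c _ _ → reflexive (Eq.cong (A (suc (suc p ℕ.+ r))) (skip-+ (suc p) k c)))) ⟩
      Y * D k ∎
      where
      M = minorℕ A 0 (suc p ℕ.+ k)
    distrib³ : ∀ s t u d → s * ((t + u) * d) ≈ s * (t * d) + s * (u * d)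
    distrib³ = solve 4 (λ s t u d → s :* ((t :+ u) :* d) := s :* (t :* d) :+ s :* (u :* d)) refl
    swap-inner : ∀ s s′ a x d → s * ((s′ * (a * x)) * d) ≈ s′ * (a * (s * (x * d)))
    swap-inner = solve 5 (λ s s′ a x d → s :* ((s′ :* (a :* x)) :* d) := s′ :* (a :* (s :* (x :* d)))) refl
    swap-outer : ∀ s s′ a y d → s * ((s′ * (a * y)) * d) ≈ (s′ * s) * (a * (y * d))
    swap-outer = solve 5 (λ s s′ a y d → s :* ((s′ :* (a :* y)) :* d) := (s′ :* s) :* (a :* (y :* d))) refl
    regroup : ∀ k → sgn k * (detℕ (suc (suc p)) (B k) * D k) ≈
                    ∑ (suc p) (λ j → sgn j * (A 0 j * (sgn k * (X j k * D k))))
                    + sgn (suc p) * (sgn k * (A 0 (suc p ℕ.+ k) * (Y * D k)))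
    regroup k = begin
      sgn k * (detℕ (suc (suc p)) (B k) * D k)
        ≈⟨ *-congˡ {sgn k} (*-congʳ (∑-last (suc p) _)) ⟩
      sgn k * ((∑ (suc p) (λ j → sgn j * (B k 0 j * X j k))
                + sgn (suc p) * (B k 0 (suc p) * detℕ (suc p) (minorℕ (B k) 0 (suc p)))) * D k)
        ≈⟨ distrib³ _ _ _ _ ⟩
      sgn k * (∑ (suc p) (λ j → sgn j * (B k 0 j * X j k)) * D k)
        + sgn k * ((sgn (suc p) * (B k 0 (suc p) * detℕ (suc p) (minorℕ (B k) 0 (suc p)))) * D k)
        ≈⟨ +-cong first-p last ⟩
      ∑ (suc p) (λ j → sgn j * (A 0 j * (sgn k * (X j k * D k))))
        + sgn (suc p) * (sgn k * (A 0 (suc p ℕ.+ k) * (Y * D k))) ∎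
      where
      first-p = begin
        sgn k * (∑ (suc p) (λ j → sgn j * (B k 0 j * X j k)) * D k)
          ≈⟨ *-congˡ {sgn k} (∑-*ʳ (suc p) (D k) _) ⟨
        sgn k * ∑ (suc p) (λ j → sgn j * (B k 0 j * X j k) * D k)
          ≈⟨ ∑-*ˡ (suc p) (sgn k) _ ⟨
        ∑ (suc p) (λ j → sgn k * (sgn j * (B k 0 j * X j k) * D k))
          ≈⟨ ∑-cong (suc p) (λ j j<p → trans
               (*-congˡ {sgn k} (*-congʳ (*-congˡ {sgn j} (*-congʳ (reflexive (Eq.cong (A 0) (prefixThen-< (suc p) k j j<p)))))))
               (swap-inner _ _ _ _ _)) ⟩
        ∑ (suc p) (λ j → sgn j * (A 0 j * (sgn k * (X j k * D k)))) ∎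
      last = begin
        sgn k * ((sgn (suc p) * (B k 0 (suc p) * detℕ (suc p) (minorℕ (B k) 0 (suc p)))) * D k)
          ≈⟨ *-congˡ {sgn k} (*-congʳ (*-congˡ {sgn (suc p)} (*-cong
               (reflexive (Eq.cong (A 0) (prefixThen-last (suc p) k)))
               (detℕ-cong (suc p) (λ r c _ c<p → reflexive (Eq.cong (A (suc r))
                 (Eq.trans (Eq.cong (prefixThen (suc p) k) (skip-below (suc p) c c<p))
                           (prefixThen-< (suc p) k c c<p)))))))) ⟩
        sgn k * ((sgn (suc p) * (A 0 (suc p ℕ.+ k) * Y)) * D k)
          ≈⟨ trans (swap-outer _ _ _ _ _) (*-assoc _ _ _) ⟩
        sgn (suc p) * (sgn k * (A 0 (suc p ℕ.+ k) * (Y * D k))) ∎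

  detℕ-lastColumn : ∀ p (A : Matrix) → detℕ (suc p) A ≈
    ∑ (suc p) (λ r → sgn (r ℕ.+ p) * (A r p * detℕ p (λ i c → A (skip r i) c)))
  detℕ-lastColumn zero A = trans (detℕ-1 A) (sym (trans (∑-1 _) (trans (*-identityˡ _) (*-identityʳ _))))
  detℕ-lastColumn (suc p) A = begin
    detℕ (suc (suc p)) A
      ≈⟨ ∑-last (suc p) _ ⟩
    ∑ (suc p) (λ j → sgn j * (A 0 j * detℕ (suc p) (minorℕ A 0 j)))
      + sgn (suc p) * (A 0 (suc p) * detℕ (suc p) (minorℕ A 0 (suc p)))
      ≈⟨ +-cong (∑-cong (suc p) (λ j j<p → *-congˡ {sgn j} (*-congˡ {A 0 j} (expand j j<p))))
                (*-congˡ {sgn (suc p)} (*-congˡ {A 0 (suc p)}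
                  (detℕ-cong (suc p) (λ i c _ c<p → reflexive (Eq.cong (A (suc i)) (skip-below (suc p) c c<p)))))) ⟩
    ∑ (suc p) (λ j → sgn j * (A 0 j * ∑ (suc p) (λ r → sgn (r ℕ.+ p) * (A (suc r) (suc p) * N r j))))
      + sgn (suc p) * (A 0 (suc p) * detℕ (suc p) (λ i c → A (suc i) c))
      ≈⟨ +-comm _ _ ⟩
    sgn (suc p) * (A 0 (suc p) * detℕ (suc p) (λ i c → A (suc i) c))
      + ∑ (suc p) (λ j → sgn j * (A 0 j * ∑ (suc p) (λ r → sgn (r ℕ.+ p) * (A (suc r) (suc p) * N r j))))
      ≈⟨ +-congˡ (trans (∑-cong (suc p) (λ j _ → ∑-*ˡ² (suc p) (sgn j) (A 0 j) _)) (∑-swap (suc p) (suc p) _)) ⟩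
    sgn (suc p) * (A 0 (suc p) * detℕ (suc p) (λ i c → A (suc i) c))
      + ∑ (suc p) (λ r → ∑ (suc p) (λ j → sgn j * (A 0 j * (sgn (r ℕ.+ p) * (A (suc r) (suc p) * N r j)))))
      ≈⟨ +-congˡ (∑-cong (suc p) (λ r _ → trans (∑-cong (suc p) (λ j _ → swap _ _ _ _ _))
            (trans (sym (∑-*ˡ² (suc p) (sgn (r ℕ.+ p)) (A (suc r) (suc p)) _)) (*-congʳ (sym (sgn-shift r)))))) ⟩
    sgn (suc p) * (A 0 (suc p) * detℕ (suc p) (λ i c → A (suc i) c))
      + ∑ (suc p) (λ r → sgn (suc r ℕ.+ suc p) * (A (suc r) (suc p) * detℕ (suc p) (λ i c → A (skip (suc r) i) c)))
      ≡⟨ Eq.sym (∑-suc (suc p) (λ r → sgn (r ℕ.+ suc p) * (A r (suc p) * detℕ (suc p) (λ i c → A (skip r i) c)))) ⟩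
    ∑ (suc (suc p)) (λ r → sgn (r ℕ.+ suc p) * (A r (suc p) * detℕ (suc p) (λ i c → A (skip r i) c))) ∎
    where
    N : ℕ → ℕ → Carrier
    N r j = detℕ p (λ i c → A (suc (skip r i)) (skip j c))
    expand : ∀ j → j < suc p →
      detℕ (suc p) (minorℕ A 0 j) ≈ ∑ (suc p) (λ r → sgn (r ℕ.+ p) * (A (suc r) (suc p) * N r j))
    expand j j<p = trans (detℕ-lastColumn p (minorℕ A 0 j))
      (∑-cong (suc p) (λ r _ → *-congˡ {sgn (r ℕ.+ p)}
        (*-congʳ (reflexive (Eq.cong (A (suc r)) (skip-above j p (ℕP.≤-pred j<p)))))))
    swap : ∀ s a s′ b d → s * (a * (s′ * (b * d))) ≈ s′ * (b * (s * (a * d)))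
    swap = solve 5 (λ s a s′ b d → s :* (a :* (s′ :* (b :* d))) := s′ :* (b :* (s :* (a :* d)))) refl
    sgn-shift : ∀ r → sgn (suc r ℕ.+ suc p) ≈ sgn (r ℕ.+ p)
    sgn-shift r = trans (reflexive (Eq.cong (λ z → sgn (suc z)) (ℕP.+-suc r p))) (sgn-2+ (r ℕ.+ p))

  ∏ : ℕ → (ℕ → Carrier) → Carrier
  ∏ zero f = 1#
  ∏ (suc n) f = f 0 * ∏ n (λ t → f (suc t))

  ∏-cong : ∀ k {f g : ℕ → Carrier} → (∀ i → i < k → f i ≈ g i) → ∏ k f ≈ ∏ k g
  ∏-cong zero f≈g = refl
  ∏-cong (suc k) f≈g = *-cong (f≈g 0 (s≤s z≤n)) (∏-cong k (λ i i<k → f≈g (suc i) (s≤s i<k)))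

  ∏-last : ∀ k (f : ℕ → Carrier) → ∏ (suc k) f ≈ ∏ k f * f k
  ∏-last zero f = trans (*-identityʳ _) (sym (*-identityˡ _))
  ∏-last (suc k) f = trans (*-congˡ (∏-last k (λ t → f (suc t)))) (sym (*-assoc _ _ _))

  ∏-split : ∀ m k (f : ℕ → Carrier) → ∏ (m ℕ.+ k) f ≈ ∏ m f * ∏ k (λ t → f (m ℕ.+ t))
  ∏-split zero k f = sym (*-identityˡ _)
  ∏-split (suc m) k f = trans (*-congˡ (∏-split m k (λ t → f (suc t)))) (sym (*-assoc _ _ _))

  record Bidiagonal (A : Matrix) (δ ε : ℕ → Carrier) (m : ℕ) : Set (c ⊔ ℓ) where
    field
      diagonal : ∀ o → o ≤ m → A o o ≈ δ o
      superdiagonal : ∀ o → o < m → A o (suc o) ≈ ε o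
      elsewhere : ∀ o o′ → o ≤ m → o′ ≤ m → o′ ≢ o → o′ ≢ suc o → A o o′ ≈ 0#

  Bidiagonal-tail : ∀ {A δ ε m} → Bidiagonal A δ ε (suc m) →
    Bidiagonal (λ o o′ → A (suc o) (suc o′)) (λ t → δ (suc t)) (λ t → ε (suc t)) m
  Bidiagonal-tail b = record
    { diagonal = λ o o≤m → diagonal (suc o) (s≤s o≤m)
    ; superdiagonal = λ o o<m → superdiagonal (suc o) (s≤s o<m)
    ; elsewhere = λ o o′ o≤m o′≤m ≢o ≢so → elsewhere (suc o) (suc o′) (s≤s o≤m) (s≤s o′≤m)
                    (λ e → ≢o (ℕP.suc-injective e)) (λ e → ≢so (ℕP.suc-injective e)) }
    where open Bidiagonal b

  -- The minor of a bidiagonal matrix without row i and column k.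
  bidiagonalMinor : (δ ε : ℕ → Carrier) → ℕ → ℕ → ℕ → Carrier
  bidiagonalMinor δ ε m i k = if k <ᵇ suc i
    then ∏ k δ * (∏ (i ∸ k) (λ t → ε (k ℕ.+ t)) * ∏ (m ∸ i) (λ t → δ (suc i ℕ.+ t)))
    else 0#

  detℕ-bidiagonalTail : ∀ m A δ ε → Bidiagonal A δ ε m →
                        detℕ m (λ r c → A (suc r) (suc c)) ≈ ∏ m (λ t → δ (suc t))
  detℕ-bidiagonalTail zero A δ ε b = refl
  detℕ-bidiagonalTail (suc m) A δ ε b = begin
    detℕ (suc m) (λ r c → A (suc r) (suc c))
      ≈⟨ detℕ-firstColumn m (λ r c → A (suc r) (suc c))
           (λ r r<m → elsewhere (suc (suc r)) 1 (s≤s r<m) (s≤s z≤n) (λ ()) (λ ())) ⟩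
    A 1 1 * detℕ m (λ r c → A (suc (suc r)) (suc (suc c)))
      ≈⟨ *-cong (diagonal 1 (s≤s z≤n)) (detℕ-bidiagonalTail m _ _ _ (Bidiagonal-tail b)) ⟩
    δ 1 * ∏ m (λ t → δ (suc (suc t))) ∎
    where open Bidiagonal b

  detℕ-bidiagonal : ∀ m i k A δ ε → Bidiagonal A δ ε m → i ≤ m → k ≤ m →
                    detℕ m (λ r c → A (skip i r) (skip k c)) ≈ bidiagonalMinor δ ε m i k
  detℕ-bidiagonal m zero zero A δ ε b _ _ =
    trans (detℕ-bidiagonalTail m A δ ε b) (sym (trans (*-identityˡ _) (*-identityˡ _)))
  detℕ-bidiagonal (suc m) zero (suc k) A δ ε b _ _ =
    detℕ-zeroColumn m (λ r c → A (suc r) (skip (suc k) c))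
      (λ r r<m → Bidiagonal.elsewhere b (suc r) 0 (s≤s (ℕP.≤-pred r<m)) z≤n (λ ()) (λ ()))
  detℕ-bidiagonal (suc m) (suc i) zero A δ ε b (s≤s i≤m) _ = begin
    detℕ (suc m) (λ r c → A (skip (suc i) r) (suc c))
      ≈⟨ detℕ-firstRow m (λ r c → A (skip (suc i) r) (suc c))
           (λ c c<m → elsewhere 0 (suc (suc c)) z≤n (s≤s c<m) (λ ()) (λ ())) ⟩
    A 0 1 * detℕ m (λ r c → A (suc (skip i r)) (suc (suc c)))
      ≈⟨ *-cong (superdiagonal 0 (s≤s z≤n)) (detℕ-bidiagonal m i 0 _ _ _ (Bidiagonal-tail b) i≤m z≤n) ⟩
    ε 0 * (1# * (∏ i (λ t → ε (suc t)) * ∏ (m ∸ i) (λ t → δ (suc (suc i ℕ.+ t)))))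
      ≈⟨ regroup _ _ _ _ ⟩
    bidiagonalMinor δ ε (suc m) (suc i) 0 ∎
    where
    open Bidiagonal b
    regroup : ∀ e o E P → e * (o * (E * P)) ≈ o * ((e * E) * P)
    regroup = solve 4 (λ e o E P → e :* (o :* (E :* P)) := o :* ((e :* E) :* P)) refl
  detℕ-bidiagonal (suc m) (suc i) (suc k) A δ ε b (s≤s i≤m) (s≤s k≤m) = begin
    detℕ (suc m) (λ r c → A (skip (suc i) r) (skip (suc k) c))
      ≈⟨ detℕ-firstColumn m (λ r c → A (skip (suc i) r) (skip (suc k) c))
           (λ r r<m → elsewhere (suc (skip i r)) 0 (skip-< i r i≤m r<m) z≤n (λ ()) (λ ())) ⟩
    A 0 0 * detℕ m (λ r c → A (suc (skip i r)) (suc (skip k c)))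
      ≈⟨ *-cong (diagonal 0 z≤n) (detℕ-bidiagonal m i k _ _ _ (Bidiagonal-tail b) i≤m k≤m) ⟩
    δ 0 * bidiagonalMinor (λ t → δ (suc t)) (λ t → ε (suc t)) m i k
      ≈⟨ absorb ⟩
    bidiagonalMinor δ ε (suc m) (suc i) (suc k) ∎
    where
    open Bidiagonal b
    absorb : δ 0 * bidiagonalMinor (λ t → δ (suc t)) (λ t → ε (suc t)) m i k ≈
             bidiagonalMinor δ ε (suc m) (suc i) (suc k)
    absorb with k <ᵇ suc i
    ... | true = sym (*-assoc _ _ _)
    ... | false = zeroʳ _

-- (x,y)-numbers and the weights W

module Weights {c ℓ : Level} (R : CommutativeRing c ℓ) (x y : CommutativeRing.Carrier R) where
  open CommutativeRing R hiding (zero)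
  open WithRing R using (pow; qnum)
  open Determinants R using (pow-+)
  open IntegerCoefficients R using (solve; _:=_; _:+_; _:*_; con)
  open import Relation.Binary.Reasoning.Setoid setoid

  private
    [_] : ℕ → Carrier
    [_] = qnum x y

  qnum-suc : ∀ s → [ suc s ] ≈ x * [ s ] + pow y s
  qnum-suc zero = solve 2 (λ x y → con (+ 1) :+ y :* con (+ 0) := x :* con (+ 0) :+ con (+ 1)) refl x y
  qnum-suc (suc s) = begin
    pow x (suc s) + y * [ suc s ]          ≈⟨ +-congˡ (*-congˡ (qnum-suc s)) ⟩
    x * pow x s + y * (x * [ s ] + pow y s) ≈⟨ regroup x y (pow x s) [ s ] (pow y s) ⟩
    x * (pow x s + y * [ s ]) + y * pow y s ∎
    where
    regroup : ∀ x y X q Y → x * X + y * (x * q + Y) ≈ x * (X + y * q) + y * Y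
    regroup = solve 5 (λ x y X q Y → x :* X :+ y :* (x :* q :+ Y) := x :* (X :+ y :* q) :+ y :* Y) refl

  qnum-+ : ∀ p s → [ p ℕ.+ s ] ≈ pow x p * [ s ] + pow y s * [ p ]
  qnum-+ zero s = solve 2 (λ q Y → q := con (+ 1) :* q :+ Y :* con (+ 0)) refl [ s ] (pow y s)
  qnum-+ (suc p) s = begin
    [ suc (p ℕ.+ s) ]                                    ≈⟨ qnum-suc (p ℕ.+ s) ⟩
    x * [ p ℕ.+ s ] + pow y (p ℕ.+ s)                    ≈⟨ +-cong (*-congˡ (qnum-+ p s)) (pow-+ y p s) ⟩
    x * (pow x p * [ s ] + pow y s * [ p ]) + pow y p * pow y s
      ≈⟨ regroup x (pow x p) [ s ] (pow y s) [ p ] (pow y p) ⟩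
    (x * pow x p) * [ s ] + pow y s * (x * [ p ] + pow y p) ≈⟨ +-congˡ (*-congˡ (sym (qnum-suc p))) ⟩
    (x * pow x p) * [ s ] + pow y s * [ suc p ]          ∎
    where
    regroup : ∀ x X q Y q′ Y′ → x * (X * q + Y * q′) + Y′ * Y ≈ (x * X) * q + Y * (x * q′ + Y′)
    regroup = solve 6 (λ x X q Y q′ Y′ → x :* (X :* q :+ Y :* q′) :+ Y′ :* Y := (x :* X) :* q :+ Y :* (x :* q′ :+ Y′)) refl

  -- W p s = x^{C(p,2)} y^{C(s,2)} times the (x,y)-binomial coefficient [p + s choose p].
  W : ℕ → ℕ → Carrier
  W zero zero = 1#
  W zero (suc s) = pow y s * W zero s
  W (suc p) zero = pow x p * W p zero
  W (suc p) (suc s) = pow x (suc p) * pow y s * W (suc p) s + pow x p * pow y (suc s) * W p (suc s)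

  W-exchange : ∀ p s → pow x p * [ suc s ] * W p (suc s) ≈ pow y s * [ suc p ] * W (suc p) s
  W-exchange zero zero = refl
  W-exchange zero (suc s) = begin
    1# * [ suc (suc s) ] * (pow y (suc s) * W 0 (suc s))
      ≈⟨ *-congʳ (*-congˡ (qnum-suc (suc s))) ⟩
    1# * (x * [ suc s ] + y * Y) * ((y * Y) * W 0 (suc s))
      ≈⟨ expand x y Y [ suc s ] (W 0 (suc s)) ⟩
    x * (y * Y) * (1# * [ suc s ] * W 0 (suc s)) + (y * Y) * (y * Y) * W 0 (suc s)
      ≈⟨ +-congʳ (*-congˡ (W-exchange 0 s)) ⟩
    x * (y * Y) * (Y * (1# + y * 0#) * W 1 s) + (y * Y) * (y * Y) * W 0 (suc s)
      ≈⟨ collect x y Y (W 1 s) (W 0 (suc s)) ⟩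
    pow y (suc s) * [ 1 ] * W 1 (suc s) ∎
    where
    Y = pow y s
    expand : ∀ x y Y q B → 1# * (x * q + y * Y) * ((y * Y) * B) ≈ x * (y * Y) * (1# * q * B) + (y * Y) * (y * Y) * B
    expand = solve 5 (λ x y Y q B → con (+ 1) :* (x :* q :+ y :* Y) :* ((y :* Y) :* B)
                                    := x :* (y :* Y) :* (con (+ 1) :* q :* B) :+ (y :* Y) :* (y :* Y) :* B) refl
    collect : ∀ x y Y C B → x * (y * Y) * (Y * (1# + y * 0#) * C) + (y * Y) * (y * Y) * B ≈
                            (y * Y) * (1# + y * 0#) * ((x * 1#) * Y * C + 1# * (y * Y) * B)
    collect = solve 5 (λ x y Y C B → x :* (y :* Y) :* (Y :* (con (+ 1) :+ y :* con (+ 0)) :* C) :+ (y :* Y) :* (y :* Y) :* B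
                                     := (y :* Y) :* (con (+ 1) :+ y :* con (+ 0)) :* ((x :* con (+ 1)) :* Y :* C :+ con (+ 1) :* (y :* Y) :* B)) refl
  W-exchange (suc p) zero = begin
    (x * X) * (1# + y * 0#) * ((x * X) * 1# * W (suc p) 0 + X * (y * 1#) * W p 1)
      ≈⟨ expand x y X (W p 1) (W (suc p) 0) ⟩
    (x * X) * (x * X) * W (suc p) 0 + (x * X) * y * (X * (1# + y * 0#) * W p 1)
      ≈⟨ +-congˡ (*-congˡ (W-exchange p 0)) ⟩
    (x * X) * (x * X) * W (suc p) 0 + (x * X) * y * (1# * [ suc p ] * W (suc p) 0)
      ≈⟨ collect x y X [ suc p ] (W (suc p) 0) ⟩
    pow y 0 * [ suc (suc p) ] * W (suc (suc p)) 0 ∎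
    where
    X = pow x p
    expand : ∀ x y X A B → (x * X) * (1# + y * 0#) * ((x * X) * 1# * B + X * (y * 1#) * A) ≈
                           (x * X) * (x * X) * B + (x * X) * y * (X * (1# + y * 0#) * A)
    expand = solve 5 (λ x y X A B → (x :* X) :* (con (+ 1) :+ y :* con (+ 0)) :* ((x :* X) :* con (+ 1) :* B :+ X :* (y :* con (+ 1)) :* A)
                                    := (x :* X) :* (x :* X) :* B :+ (x :* X) :* y :* (X :* (con (+ 1) :+ y :* con (+ 0)) :* A)) refl
    collect : ∀ x y X q B → (x * X) * (x * X) * B + (x * X) * y * (1# * q * B) ≈ 1# * (x * X + y * q) * ((x * X) * B)
    collect = solve 5 (λ x y X q B → (x :* X) :* (x :* X) :* B :+ (x :* X) :* y :* (con (+ 1) :* q :* B)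
                                     := con (+ 1) :* (x :* X :+ y :* q) :* ((x :* X) :* B)) refl
  W-exchange (suc p) (suc s) = begin
    (x * X) * q₂ₛ * ((x * X) * (y * Y) * B + X * (y * (y * Y)) * A)
      ≈⟨ expand x y X Y q₂ₛ A B ⟩
    (x * X) * (y * Y) * ((x * X) * q₂ₛ) * B + (x * X) * (y * (y * Y)) * (X * q₂ₛ * A)
      ≈⟨ +-congˡ (*-congˡ (W-exchange p (suc s))) ⟩
    (x * X) * (y * Y) * ((x * X) * q₂ₛ) * B + (x * X) * (y * (y * Y)) * ((y * Y) * q₁ₚ * B)
      ≈⟨ factor x y X Y q₂ₛ q₁ₚ B ⟩
    (x * X) * (y * Y) * B * ((x * X) * q₂ₛ + (y * (y * Y)) * q₁ₚ)
      ≈⟨ *-congˡ two-splittings ⟩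
    (x * X) * (y * Y) * B * ((x * (x * X)) * q₁ₛ + (y * Y) * q₂ₚ)
      ≈⟨ unfactor x y X Y q₁ₛ q₂ₚ B ⟩
    (x * (x * X)) * (y * Y) * ((x * X) * q₁ₛ * B) + (y * Y) * q₂ₚ * ((x * X) * (y * Y) * B)
      ≈⟨ +-congʳ (*-congˡ (W-exchange (suc p) s)) ⟩
    (x * (x * X)) * (y * Y) * (Y * q₂ₚ * C) + (y * Y) * q₂ₚ * ((x * X) * (y * Y) * B)
      ≈⟨ collect x y X Y q₂ₚ C B ⟩
    (y * Y) * q₂ₚ * ((x * (x * X)) * Y * C + (x * X) * (y * Y) * B) ∎
    where
    X = pow x p
    Y = pow y s
    A = W p (suc (suc s))
    B = W (suc p) (suc s)
    C = W (suc (suc p)) s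
    q₂ₛ = [ suc (suc s) ]
    q₁ₛ = [ suc s ]
    q₁ₚ = [ suc p ]
    q₂ₚ = [ suc (suc p) ]
    -- [p + s + 3] split after p + 1 and after p + 2.
    two-splittings : (x * X) * q₂ₛ + (y * (y * Y)) * q₁ₚ ≈ (x * (x * X)) * q₁ₛ + (y * Y) * q₂ₚ
    two-splittings = trans (sym (qnum-+ (suc p) (suc (suc s))))
      (trans (reflexive (Eq.cong [_] (ℕP.+-suc (suc p) (suc s)))) (qnum-+ (suc (suc p)) (suc s)))
    expand : ∀ x y X Y q A B → (x * X) * q * ((x * X) * (y * Y) * B + X * (y * (y * Y)) * A) ≈
                               (x * X) * (y * Y) * ((x * X) * q) * B + (x * X) * (y * (y * Y)) * (X * q * A)
    expand = solve 7 (λ x y X Y q A B → (x :* X) :* q :* ((x :* X) :* (y :* Y) :* B :+ X :* (y :* (y :* Y)) :* A)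
                                        := (x :* X) :* (y :* Y) :* ((x :* X) :* q) :* B :+ (x :* X) :* (y :* (y :* Y)) :* (X :* q :* A)) refl
    factor : ∀ x y X Y q q′ B → (x * X) * (y * Y) * ((x * X) * q) * B + (x * X) * (y * (y * Y)) * ((y * Y) * q′ * B) ≈
                                (x * X) * (y * Y) * B * ((x * X) * q + (y * (y * Y)) * q′)
    factor = solve 7 (λ x y X Y q q′ B → (x :* X) :* (y :* Y) :* ((x :* X) :* q) :* B :+ (x :* X) :* (y :* (y :* Y)) :* ((y :* Y) :* q′ :* B)
                                         := (x :* X) :* (y :* Y) :* B :* ((x :* X) :* q :+ (y :* (y :* Y)) :* q′)) refl
    unfactor : ∀ x y X Y q q′ B → (x * X) * (y * Y) * B * ((x * (x * X)) * q + (y * Y) * q′) ≈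
                                  (x * (x * X)) * (y * Y) * ((x * X) * q * B) + (y * Y) * q′ * ((x * X) * (y * Y) * B)
    unfactor = solve 7 (λ x y X Y q q′ B → (x :* X) :* (y :* Y) :* B :* ((x :* (x :* X)) :* q :+ (y :* Y) :* q′)
                                           := (x :* (x :* X)) :* (y :* Y) :* ((x :* X) :* q :* B) :+ (y :* Y) :* q′ :* ((x :* X) :* (y :* Y) :* B)) refl
    collect : ∀ x y X Y q C B → (x * (x * X)) * (y * Y) * (Y * q * C) + (y * Y) * q * ((x * X) * (y * Y) * B) ≈
                                (y * Y) * q * ((x * (x * X)) * Y * C + (x * X) * (y * Y) * B)
    collect = solve 7 (λ x y X Y q C B → (x :* (x :* X)) :* (y :* Y) :* (Y :* q :* C) :+ (y :* Y) :* q :* ((x :* X) :* (y :* Y) :* B)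
                                         := (y :* Y) :* q :* ((x :* (x :* X)) :* Y :* C :+ (x :* X) :* (y :* Y) :* B)) refl

  W-recurrence : ∀ j s → pow x j * [ suc s ] * W j (suc s) + pow x (suc j) * [ s ] * W (suc j) s
                         ≈ [ suc j ℕ.+ s ] * W (suc j) s
  W-recurrence j s = sym (begin
    [ suc j ℕ.+ s ] * W (suc j) s
      ≈⟨ *-congʳ (qnum-+ (suc j) s) ⟩
    (pow x (suc j) * [ s ] + pow y s * [ suc j ]) * W (suc j) s
      ≈⟨ distribʳ _ _ _ ⟩
    pow x (suc j) * [ s ] * W (suc j) s + pow y s * [ suc j ] * W (suc j) s
      ≈⟨ +-congˡ (W-exchange j s) ⟨
    pow x (suc j) * [ s ] * W (suc j) s + pow x j * [ suc s ] * W j (suc s)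
      ≈⟨ +-comm _ _ ⟩
    pow x j * [ suc s ] * W j (suc s) + pow x (suc j) * [ s ] * W (suc j) s ∎)

  W-recurrence-∸ : ∀ n j → j < n →
    pow x j * [ n ∸ j ] * W j (n ∸ j) + pow x (suc j) * [ n ∸ suc j ] * W (suc j) (n ∸ suc j)
      ≈ [ n ] * W (suc j) (n ∸ suc j)
  W-recurrence-∸ n j j<n = Eq.subst P (ℕP.m+[n∸m]≡n j<n) (at-suc-j+ (n ∸ suc j))
    where
    P : ℕ → Set ℓ
    P n = pow x j * [ n ∸ j ] * W j (n ∸ j) + pow x (suc j) * [ n ∸ suc j ] * W (suc j) (n ∸ suc j)
            ≈ [ n ] * W (suc j) (n ∸ suc j)
    at-suc-j+ : ∀ s → P (suc j ℕ.+ s)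
    at-suc-j+ s rewrite ℕP.m+n∸m≡n (suc j) s | Eq.sym (ℕP.+-suc j s) | ℕP.m+n∸m≡n j (suc s)
      = W-recurrence j s

  W-0 : ∀ p → W p 0 ≈ pow x (p ℕC.C 2)
  W-0 zero = refl
  W-0 (suc p) = begin
    pow x p * W p 0              ≈⟨ *-congˡ (W-0 p) ⟩
    pow x p * pow x (p ℕC.C 2)   ≈⟨ pow-+ x p (p ℕC.C 2) ⟨
    pow x (p ℕ.+ p ℕC.C 2)       ≡⟨ Eq.cong (pow x) (C2-suc p) ⟨
    pow x (suc p ℕC.C 2)         ∎

-- The matrix M_n

∧-true : ∀ {a} {A : Set a} (b : Bool) (p q : A) → (if b ∧ true then p else q) ≡ (if b then p else q)
∧-true true p q = Eq.refl
∧-true false p q = Eq.refl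

module Entries {c ℓ : Level} (R : CommutativeRing c ℓ) (a x y t u : CommutativeRing.Carrier R) where
  open CommutativeRing R hiding (zero)
  open WithRing R using (pow; qnum; entry)
  open Determinants R using (Matrix)

  -- Levels and offsets are 0-based: (l , o) is the pair (l + 1 , o + 1) of the paper.
  entryAt : ℕ → ℕ → ℕ → ℕ → ℕ → Carrier
  entryAt n l o l′ o′ = entry a x y t u n (suc l , suc o) (suc l′ , suc o′)

  Mℕ : ℕ → Matrix
  Mℕ n i j = entry a x y t u n (decode (suc i)) (decode (suc j))

  Mℕ-tri : ∀ n l o l′ o′ → o ≤ l → o′ ≤ l′ → Mℕ n (tri l ℕ.+ o) (tri l′ ℕ.+ o′) ≡ entryAt n l o l′ o′
  Mℕ-tri n l o l′ o′ o≤l o′≤l′ rewrite decode-tri l o o≤l | decode-tri l′ o′ o′≤l′ = Eq.refl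

  diagonal : ℕ → ℕ → Carrier
  diagonal l o = 1# - a * pow x o * qnum x y (l ∸ o)

  superdiagonal : ℕ → ℕ → Carrier
  superdiagonal l o = - (a * pow x o * qnum x y (l ∸ o))

  downward : ℕ → ℕ → Carrier
  downward l o = a * pow x o * pow y (l ∸ o) * qnum t u (suc l)

  entryAt-diagonal : ∀ n l o → entryAt n l o l o ≡ diagonal l o
  entryAt-diagonal n l o rewrite ≡ᵇ-refl l | ≡ᵇ-refl o = Eq.refl

  entryAt-superdiagonal : ∀ n l o → o < l → entryAt n l o l (suc o) ≡ superdiagonal l o
  entryAt-superdiagonal n l o o<l
    rewrite ≡ᵇ-refl l | ≡ᵇ-≢ (suc o) o ℕP.1+n≢n | ≡ᵇ-refl o | <ᵇ-< o l o<l = Eq.refl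

  entryAt-sameLevel : ∀ n l o o′ → o′ ≢ o → o′ ≢ suc o → entryAt n l o l o′ ≡ 0#
  entryAt-sameLevel n l o o′ ≢o ≢so
    rewrite ≡ᵇ-refl l | ≡ᵇ-≢ o′ o ≢o | ≡ᵇ-≢ o′ (suc o) ≢so | ≡ᵇ-≢ l (suc l) (λ e → ℕP.1+n≢n (Eq.sym e))
    = Eq.refl

  entryAt-otherLevel : ∀ n l o l′ o′ → l′ ≢ l → l′ ≢ suc l → entryAt n l o l′ o′ ≡ 0#
  entryAt-otherLevel n l o l′ o′ ≢l ≢sl rewrite ≡ᵇ-≢ l′ l ≢l | ≡ᵇ-≢ l′ (suc l) ≢sl = Eq.refl

  nextLevel : ℕ → ℕ → ℕ → Carrier
  nextLevel l o o′ = if (o′ ≡ᵇ o) ∨ (o′ ≡ᵇ suc o) then - downward l o else 0#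

  entryAt-nextLevel : ∀ n l o o′ → l < n → entryAt n l o (suc l) o′ ≡ nextLevel l o o′
  entryAt-nextLevel n l o o′ l<n rewrite ≡ᵇ-≢ (suc l) l ℕP.1+n≢n | ≡ᵇ-refl l | <ᵇ-< l n l<n
    = ∧-true ((o′ ≡ᵇ o) ∨ (o′ ≡ᵇ suc o)) (- downward l o) 0#

  entryAt-suc : ∀ n l o l′ o′ → l′ ≤ n → entryAt n l o l′ o′ ≡ entryAt (suc n) l o l′ o′
  entryAt-suc n l o l′ o′ l′≤n with l′ ℕ.≟ suc l
  ... | yes Eq.refl rewrite <ᵇ-< l n l′≤n | <ᵇ-< l (suc n) (ℕP.m≤n⇒m≤1+n l′≤n) = Eq.refl
  ... | no ≢sl rewrite ≡ᵇ-≢ l′ (suc l) ≢sl = Eq.refl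

  Mℕ-suc : ∀ n i j → j < tri (suc n) → Mℕ n i j ≡ Mℕ (suc n) i j
  Mℕ-suc n i j j<tri with position-of i | position-of j
  ... | position l o o≤l i≡ | position l′ o′ o′≤l′ j≡ =
    Eq.trans (Eq.cong₂ (Mℕ n) i≡ j≡)
    (Eq.trans (Mℕ-tri n l o l′ o′ o≤l o′≤l′)
    (Eq.trans (entryAt-suc n l o l′ o′ (ℕP.≤-pred (level-< l′ o′ (suc n) o′≤l′ (Eq.subst (_< tri (suc n)) j≡ j<tri))))
    (Eq.sym (Eq.trans (Eq.cong₂ (Mℕ (suc n)) i≡ j≡) (Mℕ-tri (suc n) l o l′ o′ o≤l o′≤l′)))))

module Expansion {c ℓ : Level} (R : CommutativeRing c ℓ) (a x y t u : CommutativeRing.Carrier R) where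
  open CommutativeRing R hiding (zero)
  open Determinants R
  open Entries R a x y t u
  open import Relation.Binary.Reasoning.Setoid setoid

  H : ℕ → ℕ → Carrier
  H n j = detℕ (n ℕ.+ tri n) (λ r c → Mℕ n (skip (tri n ℕ.+ j) r) (suc c))

  -- The cofactor expansion of the upper block with the extra column (n + 1 , k) of level n + 1.
  upperMinor : ℕ → ℕ → Carrier
  upperMinor n k = ∑ (suc n) (λ o → sgn (o ℕ.+ n) * (nextLevel n o k * H n o))

  levelBlock-bidiagonal : ∀ n → Bidiagonal (λ o o′ → Mℕ n (tri n ℕ.+ o) (tri n ℕ.+ o′)) (diagonal n) (superdiagonal n) n
  levelBlock-bidiagonal n = record
    { diagonal = λ o o≤n → reflexive (Eq.trans (Mℕ-tri n n o n o o≤n o≤n) (entryAt-diagonal n n o))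
    ; superdiagonal = λ o o<n → reflexive (Eq.trans (Mℕ-tri n n o n (suc o) (ℕP.<⇒≤ o<n) o<n) (entryAt-superdiagonal n n o o<n))
    ; elsewhere = λ o o′ o≤n o′≤n ≢o ≢so →
        reflexive (Eq.trans (Mℕ-tri n n o n o′ o≤n o′≤n) (entryAt-sameLevel n n o o′ ≢o ≢so)) }

  module Recurrence (n₀ j : ℕ) (j≤n : j ≤ suc n₀) where
    n : ℕ
    n = suc n₀

    p : ℕ
    p = n₀ ℕ.+ tri n₀

    A : Matrix
    A r c = Mℕ n (skip (tri n ℕ.+ j) r) (suc c)

    lowerLeft-zero : ∀ r c → r < n → c < p → A (suc p ℕ.+ r) c ≈ 0#
    lowerLeft-zero r c r<n c<p with position-of (suc c)
    ... | position l′ o′ o′≤l′ c≡ = begin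
      Mℕ n (skip (tri n ℕ.+ j) (suc p ℕ.+ r)) (suc c) ≡⟨ Eq.cong₂ (Mℕ n) (skip-+ (suc p) j r) c≡ ⟩
      Mℕ n (tri n ℕ.+ skip j r) (tri l′ ℕ.+ o′)       ≡⟨ Mℕ-tri n n (skip j r) l′ o′ (ℕP.≤-pred (skip-< j r j≤n r<n)) o′≤l′ ⟩
      entryAt n n (skip j r) l′ o′                    ≡⟨ entryAt-otherLevel n n (skip j r) l′ o′ (λ e → ℕP.<-irrefl e l′<n)
                                                                                 (λ e → ℕP.<-irrefl e (ℕP.m≤n⇒m≤1+n l′<n)) ⟩
      0# ∎
      where
      l′<n : l′ < n
      l′<n = level-< l′ o′ n o′≤l′ (Eq.subst (_< tri n) c≡ (s≤s c<p))

    lowerMinor : ∀ k → k < suc n →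
      detℕ n (λ r c → A (suc p ℕ.+ r) (p ℕ.+ skip k c)) ≈ bidiagonalMinor (diagonal n) (superdiagonal n) n j k
    lowerMinor k k<n =
      trans (detℕ-cong n (λ r c _ _ → reflexive (Eq.cong (λ z → Mℕ n z (suc p ℕ.+ skip k c)) (skip-+ (suc p) j r))))
            (detℕ-bidiagonal n j k _ (diagonal n) (superdiagonal n) (levelBlock-bidiagonal n) j≤n (ℕP.≤-pred k<n))

    upperMinor-det : ∀ k → k < suc n → detℕ (suc p) (λ r c → A r (prefixThen p k c)) ≈ upperMinor n₀ k
    upperMinor-det k k<n = begin
      detℕ (suc p) B
        ≈⟨ detℕ-lastColumn p B ⟩
      ∑ (suc p) (λ r → sgn (r ℕ.+ p) * (B r p * detℕ p (λ i c → B (skip r i) c)))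
        ≈⟨ ∑-cong (suc p) (λ r r<p → *-congˡ {sgn (r ℕ.+ p)} (*-cong (reflexive (lastColumn r r<p))
               (detℕ-cong p (λ i c i<p c<p → reflexive (rows r i c r<p i<p c<p))))) ⟩
      ∑ (suc p) G
        ≡⟨ Eq.cong (λ z → ∑ z G) size ⟩
      ∑ (tri n₀ ℕ.+ suc n₀) G
        ≈⟨ ∑-split (tri n₀) (suc n₀) G ⟩
      ∑ (tri n₀) G + ∑ (suc n₀) (λ o → G (tri n₀ ℕ.+ o))
        ≈⟨ +-cong (∑-zero (tri n₀) G lowLevels) (∑-cong (suc n₀) (λ o o<n → *-cong
              (trans (reflexive (Eq.cong sgn (rearrange (tri n₀) o n₀))) (sgn-+double (o ℕ.+ n₀) (tri n₀)))
              (*-congʳ (reflexive (Eq.trans (Mℕ-tri n n₀ o n k (ℕP.≤-pred o<n) (ℕP.≤-pred k<n))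
                                      (entryAt-nextLevel n n₀ o k ℕP.≤-refl)))))) ⟩
      0# + upperMinor n₀ k
        ≈⟨ +-identityˡ _ ⟩
      upperMinor n₀ k ∎
      where
      B : Matrix
      B r c = A r (prefixThen p k c)
      G : ℕ → Carrier
      G r = sgn (r ℕ.+ p) * (Mℕ n r (tri n ℕ.+ k) * detℕ p (λ i c → Mℕ n₀ (skip r i) (suc c)))
      rearrange : ∀ T o n → (T ℕ.+ o) ℕ.+ (n ℕ.+ T) ≡ (o ℕ.+ n) ℕ.+ (T ℕ.+ T)
      rearrange = solve-∀
      size : suc p ≡ tri n₀ ℕ.+ suc n₀
      size = Eq.trans (Eq.cong suc (ℕP.+-comm n₀ (tri n₀))) (Eq.sym (ℕP.+-suc (tri n₀) n₀))
      lastColumn : ∀ r → r < suc p → B r p ≡ Mℕ n r (tri n ℕ.+ k)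
      lastColumn r r<p = Eq.cong₂ (Mℕ n) (skip-below (tri n ℕ.+ j) r (ℕP.≤-trans r<p (ℕP.m≤m+n (suc p) j)))
                                        (Eq.cong suc (prefixThen-last p k))
      rows : ∀ r i c → r < suc p → i < p → c < p → B (skip r i) c ≡ Mℕ n₀ (skip r i) (suc c)
      rows r i c r<p i<p c<p = Eq.trans (Eq.cong₂ (Mℕ n)
            (skip-below (tri n ℕ.+ j) (skip r i) (ℕP.≤-trans (s≤s (ℕP.≤-trans (skip-≤ r i) i<p)) (ℕP.m≤m+n (suc p) j)))
            (Eq.cong suc (prefixThen-< p k c c<p)))
          (Eq.sym (Mℕ-suc n₀ (skip r i) (suc c) (s≤s c<p)))
      lowLevels : ∀ r → r < tri n₀ → G r ≈ 0#
      lowLevels r r<tri with position-of r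
      ... | position l o o≤l r≡ = *-zeroᵐ _ _ (reflexive (Eq.trans (Eq.cong (λ z → Mℕ n z (tri n ℕ.+ k)) r≡)
              (Eq.trans (Mℕ-tri n l o n k o≤l (ℕP.≤-pred k<n))
                (entryAt-otherLevel n l o n k (λ e → ℕP.<-irrefl (Eq.sym e) (ℕP.≤-trans l<n₀ (ℕP.n≤1+n n₀)))
                                            (λ e → ℕP.<-irrefl (ℕP.suc-injective (Eq.sym e)) l<n₀)))))
        where
        l<n₀ : l < n₀
        l<n₀ = level-< l o n₀ o≤l (Eq.subst (_< tri n₀) r≡ r<tri)

    H-expansion : H n j ≈ ∑ (suc n) (λ k → sgn k * (upperMinor n₀ k * bidiagonalMinor (diagonal n) (superdiagonal n) n j k))
    H-expansion = begin
      H n j                    ≡⟨ Eq.cong (λ z → detℕ z A) size ⟩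
      detℕ (p ℕ.+ suc n) A     ≈⟨ detℕ-laplaceBlock p n A lowerLeft-zero ⟩
      ∑ (suc n) (λ k → sgn k * (detℕ (suc p) (λ r c → A r (prefixThen p k c)) *
                                 detℕ n (λ r c → A (suc p ℕ.+ r) (p ℕ.+ skip k c))))
        ≈⟨ ∑-cong (suc n) (λ k k<n → *-congˡ {sgn k} (*-cong (upperMinor-det k k<n) (lowerMinor k k<n))) ⟩
      ∑ (suc n) (λ k → sgn k * (upperMinor n₀ k * bidiagonalMinor (diagonal n) (superdiagonal n) n j k)) ∎
      where
      size : n ℕ.+ tri n ≡ p ℕ.+ suc n
      size = Eq.trans (ℕP.+-comm (suc n₀) (suc p)) (Eq.sym (ℕP.+-suc p (suc n₀)))

module ClosedForm {c ℓ : Level} (R : CommutativeRing c ℓ) (a x y t u : CommutativeRing.Carrier R) where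
  open CommutativeRing R hiding (zero)
  open WithRing R using (pow; qnum; prod; qfact)
  open RingProperties ring using (-0#≈0#; -‿distribˡ-*)
  open Determinants R
  open Weights R x y
  open Entries R a x y t u
  open Expansion R a x y t u
  open IntegerCoefficients R using (solve; _:=_; _:+_; _:*_; :-_; _:-_; con)
  open import Relation.Binary.Reasoning.Setoid setoid

  private
    *-assoc⁴ : ∀ s w d e e′ → s * (w * (d * (e * e′))) ≈ (s * (w * (d * e))) * e′
    *-assoc⁴ = solve 5 (λ s w d e e′ → s :* (w :* (d :* (e :* e′))) := (s :* (w :* (d :* e))) :* e′) refl

  link : ℕ → ℕ → ℕ → Carrier
  link n o k = if (k ≡ᵇ o) ∨ (k ≡ᵇ suc o) then pow x o * pow y (n ∸ o) else 0#

  link-diagonal : ∀ n k → link n k k ≡ pow x k * pow y (n ∸ k)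
  link-diagonal n k rewrite ≡ᵇ-refl k = Eq.refl

  link-sub : ∀ n k → link n k (suc k) ≡ pow x k * pow y (n ∸ k)
  link-sub n k rewrite ≡ᵇ-≢ (suc k) k ℕP.1+n≢n | ≡ᵇ-refl k = Eq.refl

  link-zero : ∀ n o k → k ≢ o → k ≢ suc o → link n o k ≡ 0#
  link-zero n o k ≢o ≢so rewrite ≡ᵇ-≢ k o ≢o | ≡ᵇ-≢ k (suc o) ≢so = Eq.refl

  -- The defining recurrence of W, read along a level.
  W-linkSum : ∀ n k → k ≤ suc n → ∑ (suc n) (λ o → link n o k * W o (n ∸ o)) ≈ W k (suc n ∸ k)
  W-linkSum n zero _ =
    trans (∑-single (suc n) 0 _ (s≤s z≤n)
            (λ o _ o≢0 → trans (*-congʳ (reflexive (link-zero n o 0 (λ e → o≢0 (Eq.sym e)) (λ ())))) (zeroˡ _)))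
          (*-congʳ (trans (reflexive (link-diagonal n 0)) (*-identityˡ _)))
  W-linkSum n (suc k) (s≤s k≤n) with ℕP.m≤n⇒m<n∨m≡n k≤n
  ... | inj₂ Eq.refl = begin
    ∑ (suc k) (λ o → link k o (suc k) * W o (k ∸ o))
      ≈⟨ ∑-single (suc k) k _ ℕP.≤-refl (λ o o<k o≢k → trans (*-congʳ (reflexive (link-zero k o (suc k)
            (λ e → ℕP.<-irrefl (Eq.sym e) o<k) (λ e → o≢k (Eq.sym (ℕP.suc-injective e)))))) (zeroˡ _)) ⟩
    link k k (suc k) * W k (k ∸ k)
      ≡⟨ Eq.cong₂ (λ z w → z * W k w) (Eq.trans (link-sub k k) (Eq.cong (λ z → pow x k * pow y z) (ℕP.n∸n≡0 k)))
                                     (ℕP.n∸n≡0 k) ⟩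
    pow x k * 1# * W k 0
      ≈⟨ *-congʳ (*-identityʳ _) ⟩
    W (suc k) 0
      ≡⟨ Eq.cong (W (suc k)) (ℕP.n∸n≡0 k) ⟨
    W (suc k) (k ∸ k) ∎
  ... | inj₁ k<n = Eq.subst (λ m → ∑ (suc m) (λ o → link m o (suc k) * W o (m ∸ o)) ≈ W (suc k) (m ∸ k))
                            (Eq.trans (ℕP.+-suc k _) (ℕP.m+[n∸m]≡n k<n)) (interior k (n ∸ suc k))
    where
    interior : ∀ k s → ∑ (suc (k ℕ.+ suc s)) (λ o → link (k ℕ.+ suc s) o (suc k) * W o (k ℕ.+ suc s ∸ o))
                       ≈ W (suc k) (k ℕ.+ suc s ∸ k)
    interior k s = begin
      ∑ (suc (k ℕ.+ suc s)) f
        ≈⟨ ∑-pair (suc (k ℕ.+ suc s)) k f (s≤s (ℕP.≤-trans (s≤s (ℕP.m≤m+n k s)) (ℕP.≤-reflexive (Eq.sym (ℕP.+-suc k s)))))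
             (λ o _ o≢k o≢sk → trans (*-congʳ (reflexive (link-zero _ o (suc k) (λ e → o≢sk (Eq.sym e))
                                                             (λ e → o≢k (Eq.sym (ℕP.suc-injective e))))))
                                     (zeroˡ _)) ⟩
      f k + f (suc k)
        ≡⟨ Eq.cong₂ _+_ f-k f-suc-k ⟩
      pow x k * pow y (suc s) * W k (suc s) + pow x (suc k) * pow y s * W (suc k) s
        ≈⟨ +-comm _ _ ⟩
      W (suc k) (suc s)
        ≡⟨ Eq.cong (W (suc k)) e₁ ⟨
      W (suc k) (k ℕ.+ suc s ∸ k) ∎
      where
      f : ℕ → Carrier
      f o = link (k ℕ.+ suc s) o (suc k) * W o (k ℕ.+ suc s ∸ o)
      e₁ : k ℕ.+ suc s ∸ k ≡ suc s
      e₁ = ℕP.m+n∸m≡n k (suc s)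
      e₂ : k ℕ.+ suc s ∸ suc k ≡ s
      e₂ = Eq.trans (Eq.cong (_∸ suc k) (ℕP.+-suc k s)) (ℕP.m+n∸m≡n (suc k) s)
      f-k : f k ≡ pow x k * pow y (suc s) * W k (suc s)
      f-k = Eq.cong₂ (λ z w → z * W k w)
              (Eq.trans (link-sub (k ℕ.+ suc s) k) (Eq.cong (λ z → pow x k * pow y z) e₁)) e₁
      f-suc-k : f (suc k) ≡ pow x (suc k) * pow y s * W (suc k) s
      f-suc-k = Eq.cong₂ (λ z w → z * W (suc k) w)
                  (Eq.trans (link-diagonal (k ℕ.+ suc s) (suc k)) (Eq.cong (λ z → pow x (suc k) * pow y z) e₂)) e₂

  partialAlternatingSum : ℕ → ℕ → Carrier
  partialAlternatingSum n j =
    ∑ (suc j) (λ k → sgn k * (W k (n ∸ k) * (∏ k (diagonal n) * ∏ (j ∸ k) (λ t → superdiagonal n (k ℕ.+ t)))))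

  partialAlternatingSum-closed : ∀ n j → j ≤ n →
    partialAlternatingSum n j ≈ sgn j * (W j (n ∸ j) * ∏ j (λ t → diagonal n (suc t)))
  partialAlternatingSum-closed n zero _ = trans (∑-1 _) (*-congˡ {sgn 0} (*-congˡ {W 0 n} (*-identityˡ 1#)))
  partialAlternatingSum-closed n (suc j) j<n = begin
    partialAlternatingSum n (suc j)
      ≈⟨ ∑-last (suc j) f ⟩
    ∑ (suc j) f + f (suc j)
      ≈⟨ +-cong (∑-cong (suc j) (λ k k≤j → trans (*-congˡ {sgn k} (*-congˡ {W k (n ∸ k)} (*-congˡ {∏ k (diagonal n)}
                                                     (superdiagonals-last k (ℕP.≤-pred k≤j)))))
                                                   (*-assoc⁴ _ _ _ _ _)))
                (*-cong (sgn-suc j) (*-congˡ {W (suc j) (n ∸ suc j)} (*-congˡ {∏ (suc j) (diagonal n)}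
                    (reflexive (Eq.cong (λ z → ∏ z (λ t → superdiagonal n (suc j ℕ.+ t))) (ℕP.n∸n≡0 j)))))) ⟩
    ∑ (suc j) (λ k → sgn k * (W k (n ∸ k) * (∏ k (diagonal n) * ∏ (j ∸ k) (λ t → superdiagonal n (k ℕ.+ t))))
                     * superdiagonal n j)
      + (- sgn j) * (W (suc j) (n ∸ suc j) * ((diagonal n 0 * P) * 1#))
      ≈⟨ +-congʳ (trans (∑-*ʳ (suc j) (superdiagonal n j) _)
                        (*-congʳ (partialAlternatingSum-closed n j (ℕP.≤-trans (ℕP.n≤1+n j) j<n)))) ⟩
    (sgn j * (W j (n ∸ j) * P)) * superdiagonal n j + (- sgn j) * (W (suc j) (n ∸ suc j) * ((diagonal n 0 * P) * 1#))
      ≈⟨ separate (sgn j) P (W j (n ∸ j)) (W (suc j) (n ∸ suc j)) a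
                  (pow x j) (qnum x y (n ∸ j)) (pow x (suc j)) (qnum x y (n ∸ suc j)) (qnum x y n) ⟩
    (- sgn j) * (W (suc j) (n ∸ suc j) * (P * diagonal n (suc j)))
      + (- sgn j) * P * a * ((pow x j * qnum x y (n ∸ j) * W j (n ∸ j)
                              + pow x (suc j) * qnum x y (n ∸ suc j) * W (suc j) (n ∸ suc j))
                             - qnum x y n * W (suc j) (n ∸ suc j))
      ≈⟨ +-congˡ (trans (*-congˡ (trans (+-congʳ (W-recurrence-∸ n j j<n)) (-‿inverseʳ _))) (zeroʳ _)) ⟩
    (- sgn j) * (W (suc j) (n ∸ suc j) * (P * diagonal n (suc j))) + 0#
      ≈⟨ +-identityʳ _ ⟩
    (- sgn j) * (W (suc j) (n ∸ suc j) * (P * diagonal n (suc j)))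
      ≈⟨ *-cong (sgn-suc j) (*-congˡ {W (suc j) (n ∸ suc j)} (∏-last j (λ t → diagonal n (suc t)))) ⟨
    sgn (suc j) * (W (suc j) (n ∸ suc j) * ∏ (suc j) (λ t → diagonal n (suc t))) ∎
    where
    P = ∏ j (λ t → diagonal n (suc t))
    f : ℕ → Carrier
    f k = sgn k * (W k (n ∸ k) * (∏ k (diagonal n) * ∏ (suc j ∸ k) (λ t → superdiagonal n (k ℕ.+ t))))
    superdiagonals-last : ∀ k → k ≤ j → ∏ (suc j ∸ k) (λ t → superdiagonal n (k ℕ.+ t)) ≈
                                        ∏ (j ∸ k) (λ t → superdiagonal n (k ℕ.+ t)) * superdiagonal n j
    superdiagonals-last k k≤j = begin
      ∏ (suc j ∸ k) e          ≡⟨ Eq.cong (λ z → ∏ z e) (ℕP.+-∸-assoc 1 k≤j) ⟩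
      ∏ (suc (j ∸ k)) e        ≈⟨ ∏-last (j ∸ k) e ⟩
      ∏ (j ∸ k) e * e (j ∸ k)  ≡⟨ Eq.cong (λ z → ∏ (j ∸ k) e * superdiagonal n z) (ℕP.m+[n∸m]≡n k≤j) ⟩
      ∏ (j ∸ k) e * superdiagonal n j ∎
      where
      e = λ t → superdiagonal n (k ℕ.+ t)
    separate : ∀ s P Wj W₁ a X q X′ q′ N →
      (s * (Wj * P)) * (- (a * X * q)) + (- s) * (W₁ * (((1# - a * 1# * N) * P) * 1#)) ≈
      (- s) * (W₁ * (P * (1# - a * X′ * q′))) + (- s) * P * a * ((X * q * Wj + X′ * q′ * W₁) - N * W₁)
    separate = solve 10 (λ s P Wj W₁ a X q X′ q′ N →
      (s :* (Wj :* P)) :* (:- (a :* X :* q)) :+ (:- s) :* (W₁ :* (((con (+ 1) :- a :* con (+ 1) :* N) :* P) :* con (+ 1))) :=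
      (:- s) :* (W₁ :* (P :* (con (+ 1) :- a :* X′ :* q′))) :+ (:- s) :* P :* a :* ((X :* q :* Wj :+ X′ :* q′ :* W₁) :- N :* W₁)) refl

  alternatingSum-bidiagonal : ∀ n j → j ≤ n →
    ∑ (suc n) (λ k → sgn k * (W k (n ∸ k) * bidiagonalMinor (diagonal n) (superdiagonal n) n j k))
      ≈ sgn j * (W j (n ∸ j) * ∏ n (λ t → diagonal n (suc t)))
  alternatingSum-bidiagonal n j j≤n = begin
    ∑ (suc n) f
      ≡⟨ Eq.cong (λ z → ∑ z f) (Eq.cong suc (Eq.sym (ℕP.m+[n∸m]≡n j≤n))) ⟩
    ∑ (suc j ℕ.+ (n ∸ j)) f
      ≈⟨ ∑-split (suc j) (n ∸ j) f ⟩
    ∑ (suc j) f + ∑ (n ∸ j) (λ t → f (suc j ℕ.+ t))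
      ≈⟨ +-cong (∑-cong (suc j) (λ k k≤j → trans (*-congˡ {sgn k} (*-congˡ {W k (n ∸ k)} (reflexive (minor-≤ k (ℕP.≤-pred k≤j)))))
                                                 (*-assoc⁴ _ _ _ _ _)))
                (∑-zero (n ∸ j) _ (λ t _ → *-zeroʳ² (sgn (suc j ℕ.+ t)) (W (suc j ℕ.+ t) (n ∸ (suc j ℕ.+ t))) (reflexive (minor-> t)))) ⟩
    ∑ (suc j) (λ k → sgn k * (W k (n ∸ k) * (∏ k (diagonal n) * ∏ (j ∸ k) (λ t → superdiagonal n (k ℕ.+ t)))) * T) + 0#
      ≈⟨ +-identityʳ _ ⟩
    ∑ (suc j) (λ k → sgn k * (W k (n ∸ k) * (∏ k (diagonal n) * ∏ (j ∸ k) (λ t → superdiagonal n (k ℕ.+ t)))) * T)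
      ≈⟨ ∑-*ʳ (suc j) T _ ⟩
    partialAlternatingSum n j * T
      ≈⟨ *-congʳ (partialAlternatingSum-closed n j j≤n) ⟩
    sgn j * (W j (n ∸ j) * ∏ j (λ t → diagonal n (suc t))) * T
      ≈⟨ trans (*-assoc _ _ _) (*-congˡ (*-assoc _ _ _)) ⟩
    sgn j * (W j (n ∸ j) * (∏ j (λ t → diagonal n (suc t)) * T))
      ≈⟨ *-congˡ {sgn j} (*-congˡ {W j (n ∸ j)} (trans (sym (∏-split j (n ∸ j) (λ t → diagonal n (suc t))))
                                                      (reflexive (Eq.cong (λ z → ∏ z (λ t → diagonal n (suc t))) (ℕP.m+[n∸m]≡n j≤n))))) ⟩
    sgn j * (W j (n ∸ j) * ∏ n (λ t → diagonal n (suc t))) ∎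
    where
    f : ℕ → Carrier
    f k = sgn k * (W k (n ∸ k) * bidiagonalMinor (diagonal n) (superdiagonal n) n j k)
    T = ∏ (n ∸ j) (λ t → diagonal n (suc j ℕ.+ t))
    minor-≤ : ∀ k → k ≤ j → bidiagonalMinor (diagonal n) (superdiagonal n) n j k ≡
                            ∏ k (diagonal n) * (∏ (j ∸ k) (λ t → superdiagonal n (k ℕ.+ t)) * T)
    minor-≤ k k≤j rewrite <ᵇ-< k (suc j) (s≤s k≤j) = Eq.refl
    minor-> : ∀ t → bidiagonalMinor (diagonal n) (superdiagonal n) n j (suc j ℕ.+ t) ≡ 0#
    minor-> t rewrite <ᵇ-≥ (suc j ℕ.+ t) (suc j) (s≤s (ℕP.m≤m+n j t)) = Eq.refl

  rowFactor : ℕ → Carrier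
  rowFactor m = prod m (λ i → 1# - a * pow x i * qnum x y (m ∸ i ℕ.+ 1))

  F : ℕ → Carrier
  F n = prod (n ∸ 1) rowFactor

  G : ℕ → Carrier
  G n = pow a n * qfact t u n * F n

  Hclosed : ℕ → ℕ → Carrier
  Hclosed n j = sgn ((n ∸ j) ℕ.+ n ℕC.C 2) * (W j (n ∸ j) * G n)

  F-suc : ∀ n → F (suc n) ≈ F n * rowFactor n
  F-suc zero = sym (*-identityˡ _)
  F-suc (suc m) = refl

  diagonals≈rowFactor : ∀ n → ∏ (suc n) (λ t → diagonal (suc n) (suc t)) ≈ rowFactor n
  diagonals≈rowFactor n = begin
    ∏ (suc n) (λ t → diagonal (suc n) (suc t))
      ≈⟨ ∏-last n _ ⟩
    ∏ n (λ t → diagonal (suc n) (suc t)) * diagonal (suc n) (suc n)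
      ≈⟨ *-cong (∏-cong n (λ i i<n → reflexive (Eq.cong (λ z → 1# - a * pow x (suc i) * qnum x y z) (∸-shift i i<n))))
                last≈1 ⟩
    ∏ n (λ i → 1# - a * pow x (suc i) * qnum x y (n ∸ suc i ℕ.+ 1)) * 1#
      ≈⟨ *-identityʳ _ ⟩
    ∏ n (λ i → 1# - a * pow x (suc i) * qnum x y (n ∸ suc i ℕ.+ 1))
      ≈⟨ prod≈∏ n _ ⟨
    rowFactor n ∎
    where
    ∸-shift : ∀ i → i < n → n ∸ i ≡ n ∸ suc i ℕ.+ 1
    ∸-shift i i<n = Eq.trans (ℕP.+-∸-assoc 1 i<n) (ℕP.+-comm 1 (n ∸ suc i))
    last≈1 : diagonal (suc n) (suc n) ≈ 1#
    last≈1 = begin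
      1# - a * pow x (suc n) * qnum x y (n ∸ n) ≡⟨ Eq.cong (λ z → 1# - a * pow x (suc n) * qnum x y z) (ℕP.n∸n≡0 n) ⟩
      1# - a * pow x (suc n) * 0#               ≈⟨ +-congˡ (trans (-‿cong (zeroʳ _)) -0#≈0#) ⟩
      1# + 0#                                   ≈⟨ +-identityʳ _ ⟩
      1#                                        ∎
    prod≈∏ : ∀ k (f : ℕ → Carrier) → prod k f ≈ ∏ k (λ t → f (suc t))
    prod≈∏ zero f = refl
    prod≈∏ (suc k) f = trans (*-congʳ (prod≈∏ k f)) (sym (∏-last k (λ t → f (suc t))))

  sgn-cancel : ∀ o n c → o ≤ n → sgn (o ℕ.+ n) * sgn ((n ∸ o) ℕ.+ c) ≈ sgn c
  sgn-cancel o n c o≤n = begin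
    sgn (o ℕ.+ n) * sgn ((n ∸ o) ℕ.+ c)  ≈⟨ sgn-+ (o ℕ.+ n) ((n ∸ o) ℕ.+ c) ⟨
    sgn ((o ℕ.+ n) ℕ.+ ((n ∸ o) ℕ.+ c))  ≡⟨ Eq.cong sgn exponent ⟩
    sgn (c ℕ.+ (n ℕ.+ n))                ≈⟨ sgn-+double c n ⟩
    sgn c                                ∎
    where
    rearrange : ∀ o n d c → (o ℕ.+ n) ℕ.+ (d ℕ.+ c) ≡ c ℕ.+ (n ℕ.+ (o ℕ.+ d))
    rearrange = solve-∀
    exponent : (o ℕ.+ n) ℕ.+ ((n ∸ o) ℕ.+ c) ≡ c ℕ.+ (n ℕ.+ n)
    exponent = Eq.trans (rearrange o n (n ∸ o) c) (Eq.cong (λ z → c ℕ.+ (n ℕ.+ z)) (ℕP.m+[n∸m]≡n o≤n))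

  sgn-nextLevel : ∀ n j c → j ≤ suc n → sgn ((suc n ∸ j) ℕ.+ (n ℕ.+ c)) ≈ - (sgn j * sgn c)
  sgn-nextLevel n j c j≤n = begin
    sgn E                                  ≈⟨ sgn-+double E j ⟨
    sgn (E ℕ.+ (j ℕ.+ j))                  ≡⟨ Eq.cong sgn exponent ⟩
    sgn (suc (c ℕ.+ (n ℕ.+ n)) ℕ.+ j)      ≈⟨ sgn-+ (suc (c ℕ.+ (n ℕ.+ n))) j ⟩
    sgn (suc (c ℕ.+ (n ℕ.+ n))) * sgn j    ≈⟨ *-congʳ (trans (sgn-suc (c ℕ.+ (n ℕ.+ n))) (-‿cong (sgn-+double c n))) ⟩
    - sgn c * sgn j                        ≈⟨ -‿distribˡ-* _ _ ⟨
    - (sgn c * sgn j)                      ≈⟨ -‿cong (*-comm _ _) ⟩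
    - (sgn j * sgn c)                      ∎
    where
    E = (suc n ∸ j) ℕ.+ (n ℕ.+ c)
    rearrange : ∀ d j n c → (d ℕ.+ (n ℕ.+ c)) ℕ.+ (j ℕ.+ j) ≡ (c ℕ.+ (n ℕ.+ (j ℕ.+ d))) ℕ.+ j
    rearrange = solve-∀
    unfold-suc : ∀ c n → c ℕ.+ (n ℕ.+ suc n) ≡ suc (c ℕ.+ (n ℕ.+ n))
    unfold-suc = solve-∀
    exponent : E ℕ.+ (j ℕ.+ j) ≡ suc (c ℕ.+ (n ℕ.+ n)) ℕ.+ j
    exponent = Eq.trans (rearrange (suc n ∸ j) j n c)
      (Eq.trans (Eq.cong (λ z → (c ℕ.+ (n ℕ.+ z)) ℕ.+ j) (ℕP.m+[n∸m]≡n j≤n))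
                (Eq.cong (ℕ._+ j) (unfold-suc c n)))

  κ : ℕ → Carrier
  κ n = (- (a * qnum t u (suc n))) * (sgn (n ℕC.C 2) * G n)

  upperMinor-closed : ∀ n → (∀ o → o ≤ n → H n o ≈ Hclosed n o) →
                      ∀ k → k ≤ suc n → upperMinor n k ≈ κ n * W k (suc n ∸ k)
  upperMinor-closed n H≈ k k≤n = begin
    upperMinor n k                                     ≈⟨ ∑-cong (suc n) (λ o o≤n → term o (ℕP.≤-pred o≤n)) ⟩
    ∑ (suc n) (λ o → κ n * (link n o k * W o (n ∸ o))) ≈⟨ ∑-*ˡ (suc n) (κ n) _ ⟩
    κ n * ∑ (suc n) (λ o → link n o k * W o (n ∸ o))   ≈⟨ *-congˡ (W-linkSum n k k≤n) ⟩
    κ n * W k (suc n ∸ k)                              ∎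
    where
    regroup : ∀ σ σ′ a X Y T Q G → σ * ((- (a * X * Y * T)) * (σ′ * (Q * G))) ≈ ((- (a * T)) * ((σ * σ′) * G)) * ((X * Y) * Q)
    regroup = solve 8 (λ σ σ′ a X Y T Q G → σ :* ((:- (a :* X :* Y :* T)) :* (σ′ :* (Q :* G)))
                                          := ((:- (a :* T)) :* ((σ :* σ′) :* G)) :* ((X :* Y) :* Q)) refl
    term : ∀ o → o ≤ n → sgn (o ℕ.+ n) * (nextLevel n o k * H n o) ≈ κ n * (link n o k * W o (n ∸ o))
    term o o≤n with (k ≡ᵇ o) ∨ (k ≡ᵇ suc o)
    ... | true = begin
      sgn (o ℕ.+ n) * (- downward n o * H n o)
        ≈⟨ *-congˡ {sgn (o ℕ.+ n)} (*-congˡ { - downward n o} (H≈ o o≤n)) ⟩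
      sgn (o ℕ.+ n) * (- downward n o * Hclosed n o)
        ≈⟨ regroup (sgn (o ℕ.+ n)) (sgn ((n ∸ o) ℕ.+ n ℕC.C 2)) a (pow x o) (pow y (n ∸ o))
                   (qnum t u (suc n)) (W o (n ∸ o)) (G n) ⟩
      (- (a * qnum t u (suc n))) * ((sgn (o ℕ.+ n) * sgn ((n ∸ o) ℕ.+ n ℕC.C 2)) * G n) * ((pow x o * pow y (n ∸ o)) * W o (n ∸ o))
        ≈⟨ *-congʳ (*-congˡ (*-congʳ (sgn-cancel o n (n ℕC.C 2) o≤n))) ⟩
      κ n * ((pow x o * pow y (n ∸ o)) * W o (n ∸ o)) ∎
    ... | false = trans (*-zeroᵐ (sgn (o ℕ.+ n)) (H n o) refl) (sym (*-zeroᵐ (κ n) (W o (n ∸ o)) refl))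

  H-closedForm : ∀ n j → j ≤ n → H n j ≈ Hclosed n j
  H-closedForm zero zero _ = sym (trans (*-identityˡ _) (trans (*-identityˡ _) (trans (*-identityʳ _) (*-identityʳ _))))
  H-closedForm (suc n) j j≤n = begin
    H (suc n) j
      ≈⟨ Recurrence.H-expansion n j j≤n ⟩
    ∑ (suc (suc n)) (λ k → sgn k * (upperMinor n k * minor k))
      ≈⟨ ∑-cong (suc (suc n)) (λ k k≤n →
           trans (*-congˡ {sgn k} (*-congʳ (upperMinor-closed n (H-closedForm n) k (ℕP.≤-pred k≤n))))
                 (pull-out _ _ _ _)) ⟩
    ∑ (suc (suc n)) (λ k → κ n * (sgn k * (W k (suc n ∸ k) * minor k)))
      ≈⟨ ∑-*ˡ (suc (suc n)) (κ n) _ ⟩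
    κ n * ∑ (suc (suc n)) (λ k → sgn k * (W k (suc n ∸ k) * minor k))
      ≈⟨ *-congˡ (alternatingSum-bidiagonal (suc n) j j≤n) ⟩
    κ n * (sgn j * (W j (suc n ∸ j) * ∏ (suc n) (λ t → diagonal (suc n) (suc t))))
      ≈⟨ *-congˡ {κ n} (*-congˡ {sgn j} (*-congˡ {W j (suc n ∸ j)} (diagonals≈rowFactor n))) ⟩
    κ n * (sgn j * (W j (suc n ∸ j) * rowFactor n))
      ≈⟨ regroup a T (sgn (n ℕC.C 2)) (pow a n) (qfact t u n) (F n) (sgn j) (W j (suc n ∸ j)) (rowFactor n) ⟩
    (- (sgn j * sgn (n ℕC.C 2))) * (W j (suc n ∸ j) * ((a * pow a n) * (qfact t u n * T) * (F n * rowFactor n)))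
      ≈⟨ *-cong sign (*-congˡ {W j (suc n ∸ j)} (*-congˡ (sym (F-suc n)))) ⟩
    Hclosed (suc n) j ∎
    where
    T = qnum t u (suc n)
    minor : ℕ → Carrier
    minor = bidiagonalMinor (diagonal (suc n)) (superdiagonal (suc n)) (suc n) j
    pull-out : ∀ s k W m → s * ((k * W) * m) ≈ k * (s * (W * m))
    pull-out = solve 4 (λ s k W m → s :* ((k :* W) :* m) := k :* (s :* (W :* m))) refl
    regroup : ∀ a T σ A q F s W f → (- (a * T) * (σ * (A * q * F))) * (s * (W * f)) ≈
                                    (- (s * σ)) * (W * ((a * A) * (q * T) * (F * f)))
    regroup = solve 9 (λ a T σ A q F s W f → (:- (a :* T) :* (σ :* (A :* q :* F))) :* (s :* (W :* f))
                                           := (:- (s :* σ)) :* (W :* ((a :* A) :* (q :* T) :* (F :* f)))) refl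
    sign : - (sgn j * sgn (n ℕC.C 2)) ≈ sgn ((suc n ∸ j) ℕ.+ suc n ℕC.C 2)
    sign = trans (sym (sgn-nextLevel n j (n ℕC.C 2) j≤n))
                 (reflexive (Eq.cong (λ z → sgn ((suc n ∸ j) ℕ.+ z)) (Eq.sym (C2-suc n))))

  lhs≈H : ∀ n → WithRing.lhs R a x y t u n ≈ H n n
  lhs≈H n = begin
    WithRing.lhs R a x y t u n
      ≈⟨ det-cong m (λ i j → reflexive (Eq.cong (λ z → Mℕ n z (suc (toℕ j)))
           (Eq.trans (toℕ-punchIn (F.fromℕ m) i) (Eq.cong (λ z → skip z (toℕ i)) (FP.toℕ-fromℕ m))))) ⟩
    det m (λ i j → Mℕ n (skip m (toℕ i)) (suc (toℕ j)))
      ≈⟨ det≈detℕ m (λ i j → Mℕ n (skip m i) (suc j)) ⟩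
    detℕ m (λ i j → Mℕ n (skip m i) (suc j))
      ≡⟨ Eq.cong (λ z → detℕ m (λ i j → Mℕ n (skip z i) (suc j))) (ℕP.+-comm n (tri n)) ⟩
    H n n ∎
    where
    open WithRing R using (det)
    m = n ℕ.+ tri n

  Hclosed≈rhs : ∀ n → Hclosed n n ≈ WithRing.rhs R a x y t u n
  Hclosed≈rhs n = begin
    sgn ((n ∸ n) ℕ.+ C) * (W n (n ∸ n) * G n)  ≡⟨ Eq.cong (λ z → sgn (z ℕ.+ C) * (W n z * G n)) (ℕP.n∸n≡0 n) ⟩
    sgn C * (W n 0 * G n)                      ≈⟨ *-congˡ {sgn C} (*-congʳ (W-0 n)) ⟩
    sgn C * (pow x C * (pow a n * qfact t u n * F n))
      ≈⟨ regroup (sgn C) (pow x C) (pow a n) (qfact t u n) (F n) ⟩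
    WithRing.rhs R a x y t u n ∎
    where
    C = n ℕC.C 2
    regroup : ∀ s X A q F → s * (X * (A * q * F)) ≈ s * A * X * q * F
    regroup = solve 5 (λ s X A q F → s :* (X :* (A :* q :* F)) := s :* A :* X :* q :* F) refl

theorem3p7 : {c ℓ : Level} (R : CommutativeRing c ℓ) →
    (a x y t u : CommutativeRing.Carrier R) → (n : ℕ) → 1 ≤ n →
    CommutativeRing._≈_ R (WithRing.lhs R a x y t u n) (WithRing.rhs R a x y t u n)
theorem3p7 R a x y t u n _ = begin
  WithRing.lhs R a x y t u n  ≈⟨ lhs≈H n ⟩
  H n n                       ≈⟨ H-closedForm n n ℕP.≤-refl ⟩
  Hclosed n n                 ≈⟨ Hclosed≈rhs n ⟩
  WithRing.rhs R a x y t u n  ∎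
  where
  open CommutativeRing R using (setoid)
  open import Relation.Binary.Reasoning.Setoid setoid
  open Expansion R a x y t u using (H)
  open ClosedForm R a x y t u
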